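{- Let $m,n,s,k$ be integers such that $2\leqslant s\leqslant n$, $2\leqslant k\leqslant m$ and $ms=nk$, let $c\geqslant 1$, and let $\Gamma$ be an abelian group of order $nkc$. Then there exists an $\mathrm{MRS}_\Gamma(m,n;s,k;c)$ in each of the following cases: (1) $s\equiv k\equiv 0\pmod 4$; (2) $s\equiv 2\pmod 4$ and $k\equiv 0\pmod 4$; (3) $s\equiv 0\pmod 4$ and $k\equiv 2\pmod 4$; (4) $s\equiv k\equiv 2\pmod 4$ and $m\equiv n\equiv 0\pmod 2$.
   Context: For positive integers $m,n,s,k,c$ and an abelian group $\Gamma$ of order $nkc$, an $\mathrm{MRS}_\Gamma(m,n;s,k;c)$ is a set of $c$ partially filled $m\times n$ arrays (some cells may be empty) with entries in $\Gamma$ such that every element of $\Gamma$ appears exactly once and in a unique array; in every array each row has exactly $s$ filled cells and each column exactly $k$ filled cells; and there exist (not necessarily distinct) $\omega,\delta\in\Gamma$ such that in every array each row sums to $\omega$ and each column sums to $\delta$. -}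

module Defs where

open import Level using (Level)
open import Data.Nat using (ℕ; zero; suc; _+_; _*_)
open import Data.Fin using (Fin; zero; suc)
open import Data.Bool using (Bool; true; false)
open import Data.Maybe using (Maybe; just; nothing; is-just; fromMaybe)
open import Data.Product using (Σ; ∃; ∃-syntax; _×_; _,_)
open import Relation.Binary.PropositionalEquality using (_≡_)
open import Algebra.Bundles using (AbelianGroup)

count : ∀ {n} → (Fin n → Bool) → ℕ
count {zero}  P = 0
count {suc n} P = (if P zero then 1 else 0) + count (λ i → P (suc i))
  where open import Data.Bool using (if_then_else_)

module _ {a ℓ : Level} (Γ : AbelianGroup a ℓ) where
  open AbelianGroup Γ renaming (Carrier to G)

  gsum : ∀ {n} → (Fin n → G) → G
  gsum {zero}  f = ε
  gsum {suc n} f = f zero ∙ gsum (λ i → f (suc i))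

  HasOrder : ℕ → Set (a Level.⊔ ℓ)
  HasOrder N = Σ (Fin N → G) λ e →
                 (∀ i j → e i ≈ e j → i ≡ j) × (∀ g → ∃[ i ] e i ≈ g)

  -- a partially filled m × n array with entries in Γ (nothing = empty cell)
  PArray : ℕ → ℕ → Set a
  PArray m n = Fin m → Fin n → Maybe G

  record MRS (m n s k c : ℕ) : Set (a Level.⊔ ℓ) where
    field
      A : Fin c → PArray m n
      covers : ∀ g → ∃[ t ] ∃[ i ] ∃[ j ] ∃[ x ] (A t i j ≡ just x × x ≈ g)
      unique : ∀ t i j t' i' j' x y → A t i j ≡ just x → A t' i' j' ≡ just y →
               x ≈ y → (t ≡ t' × i ≡ i' × j ≡ j')
      rowFill : ∀ t i → count (λ j → is-just (A t i j)) ≡ s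
      colFill : ∀ t j → count (λ i → is-just (A t i j)) ≡ k
      ω δ : G
      rowSum : ∀ t i → gsum (λ j → fromMaybe ε (A t i j)) ≈ ω
      colSum : ∀ t j → gsum (λ i → fromMaybe ε (A t i j)) ≈ δ

-- A group Γ of order divisible by 4 has an involution t and an element ω such that neither ω nor
-- ωt is a square; otherwise counting the free orbits of y ↦ y⁻¹ on Γ ∖ {ε}, or of the Klein group
-- below (with ω = ε) on Γ ∖ {ε, t}, would give |Γ| ≢ 0 (mod 4). The reflections ρ y = ω y⁻¹ and
-- κ y = ωt y⁻¹ then generate a Klein four-group acting freely on Γ, with y · ρ y = ω and
-- y · κ y = ωt. Array t receives the labels t m s + p, p < m s, with p in row p div s and column
-- p mod n, so a row holds s consecutive labels and a column holds labels spaced n apart. The labels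
-- are sent to Γ orbit by orbit so that 2z and 2z + 1 are ρ-partners and P and P + 2w are
-- κ-partners (for P mod 4w < 2w), where 2w is 2n if 4 ∣ k and n otherwise. Each row then sums to
-- (s/2) ω and each column to (k/2) ωt.

module Submission where

open import Defs
open import Level using (Level; _⊔_)
open import Algebra.Bundles using (AbelianGroup; CommutativeMonoid)
open import Data.Bool using (Bool; if_then_else_)
open import Data.Nat using (ℕ; zero; suc; _+_; _*_; _/_; _%_; _≤_; _<_; NonZero; >-nonZero; z≤n; s≤s; z<s)
open import Data.Nat.Properties
  using (1+n≰n; +-0-commutativeMonoid; m*n≢0; +-comm; +-assoc; +-identityʳ; *-comm; *-assoc; *-zeroʳ;
         *-identityʳ; +-cancelˡ-≡; *-cancelʳ-≡; ≤-trans; <-≤-trans; ≤-total; ≤-reflexive; ≤⇒≯; <⇒≢;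
         m≤n⇒m<n∨m≡n; +-mono-≤; +-monoˡ-≤; +-monoʳ-≤; +-monoˡ-<; *-monoˡ-≤; module ≤-Reasoning)
open import Data.Nat.DivMod
  using (_mod_; DivMod; _divMod_; m≡m%n+[m/n]*n; m%n<n; m/n*n≤m; /-monoˡ-≤; m<n*o⇒m/o<n; m<n⇒m%n≡m;
         m<n⇒m/n≡0; m*n/n≡m; m*n%n≡0; [m+kn]%n≡m%n; +-distrib-/; %-distribˡ-*; m∣n⇒o%n%m≡o%m)
open import Data.Nat.Divisibility using (divides)
open import Data.Nat.Tactic.RingSolver using (solve-∀)
open import Data.Fin using (Fin; zero; suc; toℕ; fromℕ<; inject; punchIn; punchOut; combine; quotient; remainder)
  renaming (_<_ to _<ᶠ_)
open import Data.Fin.Properties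
  using (any?; all?; <-cmp; injective⇒≤; cantor-schröder-bernstein; ¬∀⟶∃¬-smallest; toℕ-injective; toℕ-inject;
         toℕ-fromℕ<; toℕ<n; toℕ-combine; combine-injective; combine-injectiveʳ; combine-remQuot; *↔×; 0≢1+n;
         suc-injective; punchOut-injective; punchInᵢ≢i; punchIn-injective; punchIn-punchOut)
  renaming (_≟_ to _≟ᶠ_; _<?_ to _<ᶠ?_)
open import Data.List using (List; _∷_; lookup; length; filter; allFin)
import Data.List.Relation.Unary.All as All
open import Data.List.Relation.Unary.All.Properties using (all-filter)
open import Data.List.Relation.Unary.AllPairs using (_∷_)
import Data.List.Relation.Unary.Any as Any
open import Data.List.Relation.Unary.Any.Properties using (lookup-index)
open import Data.List.Relation.Unary.Unique.Propositional using (Unique)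
open import Data.List.Relation.Unary.Unique.Propositional.Properties using (filter⁺; allFin⁺)
open import Data.List.Membership.Propositional.Properties using (∈-lookup; ∈-filter⁺; ∈-allFin)
open import Data.Maybe using (Maybe; just; nothing; is-just; fromMaybe; map)
open import Data.Product using (Σ; ∃; ∃₂; _×_; _,_; proj₁; proj₂)
open import Data.Product.Properties using (≡-dec)
open import Data.Sum using (_⊎_; inj₁; inj₂)
open import Data.Empty using (⊥; ⊥-elim)
open import Function using (_∘_; _↔_; Inverse; it)
open import Function.Properties.Inverse using (↔-refl)
open import Relation.Binary using (Setoid; Rel; Decidable; DecidableEquality; tri<; tri≈; tri>)
import Relation.Binary.Construct.On as On
open import Relation.Binary.PropositionalEquality as ≡ using (_≡_; _≢_)
open import Relation.Nullary using (¬_; Dec; yes; no; contradiction; ¬?; _×-dec_; _→-dec_; decidable-stable)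
open import Relation.Nullary.Decidable using (map′)
open import Relation.Unary using (Pred)

-- Quotients and remainders

module _ {d : ℕ} .{{_ : NonZero d}} where

  [r+q*d]%d≡r : ∀ {r} q → r < d → (r + q * d) % d ≡ r
  [r+q*d]%d≡r {r} q r<d = ≡.trans ([m+kn]%n≡m%n r q d) (m<n⇒m%n≡m r<d)

  r+q*d≢q′*d : ∀ {r} q q′ → 0 < r → r < d → r + q * d ≢ q′ * d
  r+q*d≢q′*d q q′ 0<r r<d eq =
    <⇒≢ 0<r (≡.trans (≡.sym (m*n%n≡0 q′ d)) (≡.trans (≡.cong (_% d) (≡.sym eq)) ([r+q*d]%d≡r q r<d)))

  [r+q*d]/d≡q : ∀ {r} q → r < d → (r + q * d) / d ≡ q
  [r+q*d]/d≡q {r} q r<d = begin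
    (r + q * d) / d      ≡⟨ +-distrib-/ r (q * d) (≡.subst (_< d) (≡.sym r%d+0) r<d) ⟩
    r / d + q * d / d    ≡⟨ ≡.cong₂ _+_ (m<n⇒m/n≡0 r<d) (m*n/n≡m q d) ⟩
    q                    ∎
    where
      open ≡.≡-Reasoning
      r%d+0 : r % d + q * d % d ≡ r
      r%d+0 = ≡.trans (≡.cong₂ _+_ (m<n⇒m%n≡m r<d) (m*n%n≡0 q d)) (+-identityʳ r)

  [r+q*d]mod-d≡r : ∀ r q → (toℕ r + q * d) mod d ≡ r
  [r+q*d]mod-d≡r r q = toℕ-injective (≡.trans (toℕ-fromℕ< _) ([r+q*d]%d≡r q (toℕ<n r)))

  toℕ-mod+div : ∀ P → toℕ (P mod d) + (P / d) * d ≡ P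
  toℕ-mod+div P = ≡.sym (DivMod.property (P divMod d))

  r+q*d<Q*d : ∀ {r q Q} → r < d → q < Q → r + q * d < Q * d
  r+q*d<Q*d {q = q} r<d q<Q = <-≤-trans (+-monoˡ-< (q * d) r<d) (*-monoˡ-≤ d q<Q)

  toℕ[i]mod-d≡i : ∀ (i : Fin d) → toℕ i mod d ≡ i
  toℕ[i]mod-d≡i i = toℕ-injective (≡.trans (toℕ-fromℕ< _) (m<n⇒m%n≡m (toℕ<n i)))

  mod-div-injective : ∀ {P P′} → P mod d ≡ P′ mod d → P / d ≡ P′ / d → P ≡ P′
  mod-div-injective {P} {P′} eq-mod eq-div = ≡.trans (≡.sym (toℕ-mod+div P))
    (≡.trans (≡.cong₂ (λ r q → toℕ r + q * d) eq-mod eq-div) (toℕ-mod+div P′))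

private
  /-%-injective-≤ : ∀ {s n} .{{_ : NonZero s}} .{{_ : NonZero n}} → s ≤ n →
                    ∀ {P P′} → P ≤ P′ → P / s ≡ P′ / s → P % n ≡ P′ % n → P ≡ P′
  /-%-injective-≤ {s} {n} s≤n {P} {P′} P≤P′ eq/ eq% =
    ≡.trans (m≡m%n+[m/n]*n P n)
      (≡.trans (≡.cong₂ (λ r q → r + q * n) eq% same-quotient) (≡.sym (m≡m%n+[m/n]*n P′ n)))
    where
      P′<P+n : P′ < P + n
      P′<P+n = begin-strict
        P′                   ≡⟨ m≡m%n+[m/n]*n P′ s ⟩
        P′ % s + P′ / s * s  <⟨ +-monoˡ-< (P′ / s * s) (m%n<n P′ s) ⟩
        s + P′ / s * s       ≡⟨ ≡.cong (λ q → s + q * s) eq/ ⟨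
        s + P / s * s        ≤⟨ +-monoʳ-≤ s (m/n*n≤m P s) ⟩
        s + P                ≤⟨ +-monoˡ-≤ P s≤n ⟩
        n + P                ≡⟨ +-comm n P ⟩
        P + n                ∎
        where open ≤-Reasoning

      -- P and P′ differ by less than n, so they lie in the same block of n
      same-quotient : P / n ≡ P′ / n
      same-quotient with m≤n⇒m<n∨m≡n (/-monoˡ-≤ n P≤P′)
      ... | inj₂ eq = eq
      ... | inj₁ lt = contradiction P′<P+n (≤⇒≯ (begin
        P + n                    ≡⟨ ≡.cong (_+ n) (m≡m%n+[m/n]*n P n) ⟩
        P % n + P / n * n + n    ≡⟨ +-assoc (P % n) _ n ⟩
        P % n + (P / n * n + n)  ≡⟨ ≡.cong (P % n +_) (+-comm _ n) ⟩
        P % n + suc (P / n) * n  ≤⟨ +-mono-≤ (≤-reflexive eq%) (*-monoˡ-≤ n lt) ⟩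
        P′ % n + P′ / n * n      ≡⟨ m≡m%n+[m/n]*n P′ n ⟨
        P′                       ∎))
        where open ≤-Reasoning

/-%-injective : ∀ {s n} .{{_ : NonZero s}} .{{_ : NonZero n}} → s ≤ n →
                ∀ {P P′} → P / s ≡ P′ / s → P % n ≡ P′ % n → P ≡ P′
/-%-injective s≤n {P} {P′} eq/ eq% with ≤-total P P′
... | inj₁ P≤P′ = /-%-injective-≤ s≤n P≤P′ eq/ eq%
... | inj₂ P′≤P = ≡.sym (/-%-injective-≤ s≤n P′≤P (≡.sym eq/) (≡.sym eq%))

-- Finite sets and setoids

inject-fromℕ< : ∀ {n} {i j : Fin n} (j<i : j <ᶠ i) → inject (fromℕ< j<i) ≡ j
inject-fromℕ< j<i = toℕ-injective (≡.trans (toℕ-inject _) (toℕ-fromℕ< j<i))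

lookup-injective : ∀ {a} {A : Set a} {xs : List A} → Unique xs →
                   ∀ i j → lookup xs i ≡ lookup xs j → i ≡ j
lookup-injective {xs = _ ∷ _} _          zero    zero    _  = ≡.refl
lookup-injective {xs = _ ∷ _} (x∉ ∷ _)   zero    (suc j) eq = ⊥-elim (All.lookup x∉ (∈-lookup j) eq)
lookup-injective {xs = _ ∷ _} (x∉ ∷ _)   (suc i) zero    eq = ⊥-elim (All.lookup x∉ (∈-lookup i) (≡.sym eq))
lookup-injective {xs = _ ∷ _} (_ ∷ uniq) (suc i) (suc j) eq = ≡.cong suc (lookup-injective uniq i j eq)

-- f identifies i ≢ j, so a section of f misses i or j and would inject Fin (suc n) into Fin n.
surjective⇒injective : ∀ {n} (f : Fin n → Fin n) → (∀ j → ∃ λ i → f i ≡ j) →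
                       ∀ i j → f i ≡ f j → i ≡ j
surjective⇒injective {suc n} f surj i j fi≡fj with i ≟ᶠ j
... | yes i≡j = i≡j
... | no i≢j = contradiction (injective⇒≤ {f = g′} g′-injective) 1+n≰n
  where
    g : Fin (suc n) → Fin (suc n)
    g y = proj₁ (surj y)

    f∘g : ∀ y → f (g y) ≡ y
    f∘g y = proj₂ (surj y)

    g-injective : ∀ {x y} → g x ≡ g y → x ≡ y
    g-injective {x} {y} eq = ≡.trans (≡.sym (f∘g x)) (≡.trans (≡.cong f eq) (f∘g y))

    missed : ∃ λ z → ∀ y → g y ≢ z
    missed with any? (λ y → g y ≟ᶠ i)
    ... | no ¬hit = i , λ y gy≡i → ¬hit (y , gy≡i)
    ... | yes (u , gu≡i) = j , λ v gv≡j → i≢j (≡.trans (≡.sym gu≡i) (≡.trans (≡.cong g (u≡ v gv≡j)) gv≡j))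
      where
        u≡ : ∀ v → g v ≡ j → u ≡ v
        u≡ v gv≡j = ≡.trans (≡.sym (f∘g u))
                      (≡.trans (≡.cong f gu≡i) (≡.trans fi≡fj (≡.trans (≡.cong f (≡.sym gv≡j)) (f∘g v))))

    avoids : ∀ y → proj₁ missed ≢ g y
    avoids y eq = proj₂ missed y (≡.sym eq)

    g′ : Fin (suc n) → Fin n
    g′ y = punchOut (avoids y)

    g′-injective : ∀ {x y} → g′ x ≡ g′ y → x ≡ y
    g′-injective {x} {y} eq = g-injective (punchOut-injective (avoids x) (avoids y) eq)

module _ {a} {B : Set a} (_≟_ : DecidableEquality B) {N : ℕ} (f : Fin N → B) where

  preimage : B → Maybe (Fin N)
  preimage y with any? (λ i → f i ≟ y)
  ... | yes (i , _) = just i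
  ... | no _        = nothing

  preimage-sound : ∀ {y i} → preimage y ≡ just i → f i ≡ y
  preimage-sound {y} eq with any? (λ i → f i ≟ y)
  preimage-sound {y} ≡.refl | yes (i , fi≡y) = fi≡y

  preimage-complete : (∀ {i j} → f i ≡ f j → i ≡ j) → ∀ i → preimage (f i) ≡ just i
  preimage-complete f-injective i with any? (λ j → f j ≟ f i)
  ... | yes (j , fj≡fi) = ≡.cong just (f-injective fj≡fi)
  ... | no ∄            = contradiction (i , ≡.refl) ∄

module _ {a ℓ} (S : Setoid a ℓ) where
  open Setoid S

  -- HasOrder Γ N unfolds to Enumeration (AbelianGroup.setoid Γ) N.
  Enumeration : ℕ → Set (a ⊔ ℓ)
  Enumeration N = Σ (Fin N → Carrier) λ e →
                    (∀ i j → e i ≈ e j → i ≡ j) × (∀ x → ∃ λ i → e i ≈ x)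

  _∖_ : Carrier → Setoid (a ⊔ ℓ) ℓ
  _∖_ x₀ = On.setoid S (proj₁ {B = λ y → ¬ y ≈ x₀})

module FiniteSetoid {a ℓ} (S : Setoid a ℓ) {N : ℕ} (enum : Enumeration S N) where
  open Setoid S

  enumerate : Fin N → Carrier
  enumerate = proj₁ enum

  enumerate-injective : ∀ i j → enumerate i ≈ enumerate j → i ≡ j
  enumerate-injective = proj₁ (proj₂ enum)

  index : Carrier → Fin N
  index x = proj₁ (proj₂ (proj₂ enum) x)

  enumerate-index : ∀ x → enumerate (index x) ≈ x
  enumerate-index x = proj₂ (proj₂ (proj₂ enum) x)

  index-cong : ∀ {x y} → x ≈ y → index x ≡ index y
  index-cong {x} {y} x≈y =
    enumerate-injective _ _ (trans (enumerate-index x) (trans x≈y (sym (enumerate-index y))))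

  index-injective : ∀ {x y} → index x ≡ index y → x ≈ y
  index-injective {x} {y} eq =
    trans (sym (enumerate-index x)) (trans (reflexive (≡.cong enumerate eq)) (enumerate-index y))

  _≟_ : Decidable _≈_
  x ≟ y with index x ≟ᶠ index y
  ... | yes eq = yes (index-injective eq)
  ... | no neq = no (neq ∘ index-cong)

  any?ₛ : ∀ {p} {P : Pred Carrier p} → (∀ {x y} → x ≈ y → P x → P y) →
          (∀ x → Dec (P x)) → Dec (∃ P)
  any?ₛ resp P? with any? (P? ∘ enumerate)
  ... | yes (i , Pi) = yes (enumerate i , Pi)
  ... | no ¬P = no λ (x , Px) → ¬P (index x , resp (sym (enumerate-index x)) Px)

  inhabited⇒suc : Carrier → ∃ λ M → N ≡ suc M
  inhabited⇒suc x = size (index x)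
    where
      size : ∀ {n} → Fin n → ∃ λ M → n ≡ suc M
      size {suc M} _ = M , ≡.refl

  remove : ∀ {M} → N ≡ suc M → ∀ x₀ → Enumeration (S ∖ x₀) M
  remove ≡.refl x₀ = e′ , e′-injective , e′-surjective
    where
      i₀ = index x₀

      e′ : Fin _ → Σ Carrier λ y → ¬ y ≈ x₀
      e′ k = enumerate (punchIn i₀ k) , λ eq →
               punchInᵢ≢i i₀ k (enumerate-injective _ _ (trans eq (sym (enumerate-index x₀))))

      e′-injective : ∀ i j → proj₁ (e′ i) ≈ proj₁ (e′ j) → i ≡ j
      e′-injective i j eq = punchIn-injective i₀ i j (enumerate-injective _ _ eq)

      e′-surjective : ∀ y → ∃ λ k → proj₁ (e′ k) ≈ proj₁ y
      e′-surjective (y , y≉x₀) =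
        punchOut i₀≢ , ≡.subst (λ z → enumerate z ≈ y) (≡.sym (punchIn-punchOut i₀≢)) (enumerate-index y)
        where
          i₀≢ : i₀ ≢ index y
          i₀≢ eq = y≉x₀ (trans (sym (enumerate-index y))
                          (trans (reflexive (≡.cong enumerate (≡.sym eq))) (enumerate-index x₀)))

-- Transversals of free actions

module FreeAction {a ℓ} (S : Setoid a ℓ) {N : ℕ} (enum : Enumeration S N)
  {A : Set} {r : ℕ} (Fin↔A : Fin r ↔ A) (act : Setoid.Carrier S → A → Setoid.Carrier S) where

  open Setoid S renaming (refl to ≈-refl)
  open FiniteSetoid S enum
  open Inverse Fin↔A using (to; from; strictlyInverseˡ; strictlyInverseʳ)

  record Transversal : Set (a ⊔ ℓ) where
    field
      R          : ℕ
      rep        : Fin R → Carrier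
      rep-unique : ∀ q q′ u u′ → act (rep q) u ≈ act (rep q′) u′ → q ≡ q′ × u ≡ u′
      rep-cover  : ∀ x → ∃₂ λ q u → act (rep q) u ≈ x

  transversal-size : (T : Transversal) → Transversal.R T * r ≡ N
  transversal-size T = cantor-schröder-bernstein {f = f} {g = g} f-injective g-injective
    where
      open Transversal T

      f : Fin (R * r) → Fin N
      f k = index (act (rep (quotient r k)) (to (remainder {R} r k)))

      f-injective : ∀ {k k′} → f k ≡ f k′ → k ≡ k′
      f-injective {k} {k′} eq with rep-unique _ _ _ _ (index-injective eq)
      ... | q≡q′ , u≡u′ = ≡.trans (≡.sym (combine-remQuot {R} r k))
          (≡.trans (≡.cong₂ combine q≡q′ (to-injective u≡u′)) (combine-remQuot {R} r k′))
        where
          to-injective : ∀ {i j} → to i ≡ to j → i ≡ j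
          to-injective {i} {j} e = ≡.trans (≡.sym (strictlyInverseʳ i)) (≡.trans (≡.cong from e) (strictlyInverseʳ j))

      g : Fin N → Fin (R * r)
      g i = let q , u , _ = rep-cover (enumerate i) in combine q (from u)

      g-injective : ∀ {i i′} → g i ≡ g i′ → i ≡ i′
      g-injective {i} {i′} eq with rep-cover (enumerate i) | rep-cover (enumerate i′)
      ... | q , u , eqᵢ | q′ , u′ , eqᵢ′ with combine-injective q (from u) q′ (from u′) eq
      ... | ≡.refl , from-eq =
        enumerate-injective i i′ (trans (sym eqᵢ) (trans (reflexive (≡.cong (act (rep q)) u≡u′)) eqᵢ′))
        where
          u≡u′ : u ≡ u′
          u≡u′ = ≡.trans (≡.sym (strictlyInverseˡ u)) (≡.trans (≡.cong to from-eq) (strictlyInverseˡ u′))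

  module _ (act-cong  : ∀ {x y} u → x ≈ y → act x u ≈ act y u)
           (act-refl  : ∀ x → ∃ λ u → act x u ≈ x)
           (act-sym   : ∀ x u → ∃ λ v → act (act x u) v ≈ x)
           (act-trans : ∀ x u v → ∃ λ w → act (act x u) v ≈ act x w)
           (act-free  : ∀ x u v → act x u ≈ act x v → u ≡ v) where

    _∼_ : Rel Carrier ℓ
    x ∼ y = ∃ λ u → act x u ≈ y

    ∼-refl : ∀ x → x ∼ x
    ∼-refl = act-refl

    ∼-sym : ∀ {x y} → x ∼ y → y ∼ x
    ∼-sym {x} (u , eq) = let v , eq′ = act-sym x u in v , trans (act-cong v (sym eq)) eq′

    ∼-trans : ∀ {x y z} → x ∼ y → y ∼ z → x ∼ z
    ∼-trans {x} (u , eq) (v , eq′) = let w , eq″ = act-trans x u v in w , trans (sym eq″) (trans (act-cong v eq) eq′)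

    _∼?_ : Decidable _∼_
    x ∼? y with any? (λ k → act x (to k) ≟ y)
    ... | yes (k , eq) = yes (to k , eq)
    ... | no ¬∼ = no λ (u , eq) → ¬∼ (from u , trans (reflexive (≡.cong (act x) (strictlyInverseˡ u))) eq)

    -- each orbit is represented by the least index of its elements
    Minimal : Fin N → Set ℓ
    Minimal i = ∀ j → j <ᶠ i → ¬ enumerate i ∼ enumerate j

    minimal? : ∀ i → Dec (Minimal i)
    minimal? i = all? λ j → (j <ᶠ? i) →-dec ¬? (enumerate i ∼? enumerate j)

    minimal-unique : ∀ {i j} → Minimal i → Minimal j → enumerate i ∼ enumerate j → i ≡ j
    minimal-unique {i} {j} min-i min-j i∼j with <-cmp i j
    ... | tri< i<j _ _ = contradiction (∼-sym i∼j) (min-j i i<j)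
    ... | tri≈ _ i≡j _ = i≡j
    ... | tri> _ _ j<i = contradiction i∼j (min-i j j<i)

    minimal-exists : ∀ x → ∃ λ i → Minimal i × x ∼ enumerate i
    minimal-exists x with ¬∀⟶∃¬-smallest N (λ i → ¬ x ∼ enumerate i) (λ i → ¬? (x ∼? enumerate i))
                            (λ ∀≁ → ∀≁ (index x) x∼enumerate-index)
      where
        x∼enumerate-index : x ∼ enumerate (index x)
        x∼enumerate-index = let u , eq = ∼-refl x in u , trans eq (sym (enumerate-index x))
    ... | i , ¬¬x∼i , below = i , minimal , x∼i
      where
        x∼i = decidable-stable (x ∼? enumerate i) ¬¬x∼i
        minimal : Minimal i
        minimal j j<i i∼j = below (fromℕ< j<i)
          (∼-trans x∼i (≡.subst (λ k → enumerate i ∼ enumerate k) (≡.sym (inject-fromℕ< j<i)) i∼j))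

    abstract
      transversal : Transversal
      transversal = record { R = length reps ; rep = rep ; rep-unique = rep-unique ; rep-cover = rep-cover }
        where
          reps : List (Fin N)
          reps = filter minimal? (allFin N)

          rep : Fin (length reps) → Carrier
          rep q = enumerate (lookup reps q)

          rep-unique : ∀ q q′ u u′ → act (rep q) u ≈ act (rep q′) u′ → q ≡ q′ × u ≡ u′
          rep-unique q q′ u u′ eq with lookup-injective (filter⁺ minimal? (allFin⁺ N)) q q′
                 (minimal-unique (All.lookup (all-filter minimal? (allFin N)) (∈-lookup q))
                                 (All.lookup (all-filter minimal? (allFin N)) (∈-lookup q′))
                                 (∼-trans (u , eq) (∼-sym (u′ , ≈-refl))))
          ... | ≡.refl = ≡.refl , act-free (rep q) u u′ eq

          rep-cover : ∀ x → ∃₂ λ q u → act (rep q) u ≈ x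
          rep-cover x with minimal-exists x
          ... | i , min-i , x∼i with ∼-sym x∼i | ∈-filter⁺ minimal? (∈-allFin i) min-i
          ...   | u , eq | i∈reps = Any.index i∈reps , u ,
                    trans (reflexive (≡.cong (λ k → act (enumerate k) u) (≡.sym (lookup-index i∈reps)))) eq

-- Finite sums

module FiniteSums {c ℓ} (M : CommutativeMonoid c ℓ) where
  open CommutativeMonoid M
  open import Algebra.Properties.CommutativeMonoid.Sum M
    using (sum-remove; sum-cong-≋; sum-replicate-zero)
  open import Algebra.Properties.CommutativeMonoid.Sum M public using (sum; sum-cong-≗)
  open import Algebra.Properties.Monoid.Mult monoid using (×-homo-+)
  open import Algebra.Properties.Monoid.Mult monoid public using () renaming (_×_ to _·_)
  open import Algebra.Properties.CommutativeSemigroup commutativeSemigroup using (interchange)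
  open import Relation.Binary.Reasoning.Setoid setoid

  sum-reindex : ∀ {m n} (f : Fin n → Carrier) (h : Fin m → Fin n) → (∀ {u v} → h u ≡ h v → u ≡ v) →
                (∀ j → (∀ u → h u ≢ j) → f j ≈ ε) → sum f ≈ sum (f ∘ h)
  sum-reindex {zero} {n} f h _ vanish = trans (sum-cong-≋ (λ j → vanish j λ ())) (sum-replicate-zero n)
  sum-reindex {suc m} {zero} f h _ _ with h zero
  ... | ()
  sum-reindex {suc m} {suc n} f h h-injective vanish = begin
    sum f                            ≈⟨ sum-remove {i = h₀} f ⟩
    f h₀ ∙ sum (f ∘ punchIn h₀)      ≈⟨ ∙-congˡ (sum-reindex (f ∘ punchIn h₀) h′ h′-injective vanish′) ⟩
    f h₀ ∙ sum (f ∘ punchIn h₀ ∘ h′) ≡⟨ ≡.cong (f h₀ ∙_) (sum-cong-≗ (≡.cong f ∘ punchIn-punchOut ∘ h₀≢)) ⟩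
    f h₀ ∙ sum (f ∘ h ∘ suc)         ∎
    where
      h₀ = h zero

      h₀≢ : ∀ u → h₀ ≢ h (suc u)
      h₀≢ u = 0≢1+n ∘ h-injective

      h′ : Fin m → Fin n
      h′ u = punchOut (h₀≢ u)

      punchIn-h′ : ∀ u → punchIn h₀ (h′ u) ≡ h (suc u)
      punchIn-h′ = punchIn-punchOut ∘ h₀≢

      h′-injective : ∀ {u v} → h′ u ≡ h′ v → u ≡ v
      h′-injective {u} {v} eq = suc-injective (h-injective
        (≡.trans (≡.sym (punchIn-h′ u)) (≡.trans (≡.cong (punchIn h₀) eq) (punchIn-h′ v))))

      vanish′ : ∀ j → (∀ u → h′ u ≢ j) → f (punchIn h₀ j) ≈ ε
      vanish′ j j∉ = vanish (punchIn h₀ j) λ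
        { zero    eq → punchInᵢ≢i h₀ j (≡.sym eq)
        ; (suc u) eq → j∉ u (punchIn-injective h₀ _ _ (≡.trans (punchIn-h′ u) eq)) }

  ∑ℕ : ℕ → (ℕ → Carrier) → Carrier
  ∑ℕ zero    F = ε
  ∑ℕ (suc n) F = F 0 ∙ ∑ℕ n (F ∘ suc)

  ∑ℕ-cong : ∀ n {F G} → (∀ i → F i ≈ G i) → ∑ℕ n F ≈ ∑ℕ n G
  ∑ℕ-cong zero    F≈G = refl
  ∑ℕ-cong (suc n) F≈G = ∙-cong (F≈G 0) (∑ℕ-cong n (F≈G ∘ suc))

  sum-toℕ : ∀ n (F : ℕ → Carrier) → sum {n} (F ∘ toℕ) ≡ ∑ℕ n F
  sum-toℕ zero    F = ≡.refl
  sum-toℕ (suc n) F = ≡.cong (F 0 ∙_) (sum-toℕ n (F ∘ suc))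

  ∑ℕ-+ : ∀ a b F → ∑ℕ (a + b) F ≈ ∑ℕ a F ∙ ∑ℕ b (λ i → F (a + i))
  ∑ℕ-+ zero    b F = sym (identityˡ _)
  ∑ℕ-+ (suc a) b F = trans (∙-congˡ (∑ℕ-+ a b (F ∘ suc))) (sym (assoc _ _ _))

  ∑ℕ-distrib : ∀ n F G → ∑ℕ n (λ i → F i ∙ G i) ≈ ∑ℕ n F ∙ ∑ℕ n G
  ∑ℕ-distrib zero    F G = sym (identityˡ ε)
  ∑ℕ-distrib (suc n) F G = begin
    (F 0 ∙ G 0) ∙ ∑ℕ n (λ i → F (suc i) ∙ G (suc i))   ≈⟨ ∙-congˡ (∑ℕ-distrib n (F ∘ suc) (G ∘ suc)) ⟩
    (F 0 ∙ G 0) ∙ (∑ℕ n (F ∘ suc) ∙ ∑ℕ n (G ∘ suc))    ≈⟨ interchange _ _ _ _ ⟩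
    (F 0 ∙ ∑ℕ n (F ∘ suc)) ∙ (G 0 ∙ ∑ℕ n (G ∘ suc))    ∎

  ∑ℕ-const : ∀ n F {d} → (∀ i → i < n → F i ≈ d) → ∑ℕ n F ≈ n · d
  ∑ℕ-const zero    F _     = refl
  ∑ℕ-const (suc n) F F≈d = ∙-cong (F≈d 0 (s≤s z≤n)) (∑ℕ-const n (F ∘ suc) (λ i i<n → F≈d (suc i) (s≤s i<n)))

  ∑ℕ-pairs : ∀ Y h F {d} → (∀ z i → i < h → F (z * (h + h) + i) ∙ F (z * (h + h) + (h + i)) ≈ d) →
             ∑ℕ (Y * (h + h)) F ≈ (Y * h) · d
  ∑ℕ-pairs zero    h F pairs = refl
  ∑ℕ-pairs (suc Y) h F {d} pairs = begin
    ∑ℕ (h + h + Y * (h + h)) F                                  ≈⟨ ∑ℕ-+ (h + h) _ F ⟩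
    ∑ℕ (h + h) F ∙ ∑ℕ (Y * (h + h)) (λ i → F (h + h + i))       ≈⟨ ∙-cong block rest ⟩
    h · d ∙ (Y * h) · d                                          ≈⟨ sym (×-homo-+ d h (Y * h)) ⟩
    (h + Y * h) · d                                              ∎
    where
      block : ∑ℕ (h + h) F ≈ h · d
      block = begin
        ∑ℕ (h + h) F                           ≈⟨ ∑ℕ-+ h h F ⟩
        ∑ℕ h F ∙ ∑ℕ h (λ i → F (h + i))        ≈⟨ sym (∑ℕ-distrib h F _) ⟩
        ∑ℕ h (λ i → F i ∙ F (h + i))           ≈⟨ ∑ℕ-const h _ (pairs 0) ⟩
        h · d                                  ∎

      shift : ∀ z i → h + h + (z * (h + h) + i) ≡ suc z * (h + h) + i
      shift z i = ≡.sym (+-assoc (h + h) (z * (h + h)) i)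

      rest : ∑ℕ (Y * (h + h)) (λ i → F (h + h + i)) ≈ (Y * h) · d
      rest = ∑ℕ-pairs Y h _ λ z i i<h →
        trans (reflexive (≡.cong₂ (λ p q → F p ∙ F q) (shift z i) (shift z (h + i)))) (pairs (suc z) i i<h)

count≡sum : ∀ {n} (P : Fin n → Bool) →
            count P ≡ FiniteSums.sum +-0-commutativeMonoid (λ i → if P i then 1 else 0)
count≡sum {zero}  P = ≡.refl
count≡sum {suc n} P = ≡.cong ((if P zero then 1 else 0) +_) (count≡sum (P ∘ suc))

gsum≡sum : ∀ {a ℓ} (Γ : AbelianGroup a ℓ) {n} (f : Fin n → AbelianGroup.Carrier Γ) →
           gsum Γ f ≡ FiniteSums.sum (AbelianGroup.commutativeMonoid Γ) f
gsum≡sum Γ {zero}  f = ≡.refl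
gsum≡sum Γ {suc n} f = ≡.cong (AbelianGroup._∙_ Γ (f zero)) (gsum≡sum Γ (f ∘ suc))

-- Reflections and the Klein four-group

_⊕_ : Fin 2 → Fin 2 → Fin 2
zero     ⊕ j        = j
suc zero ⊕ zero     = suc zero
suc zero ⊕ suc zero = zero

⊕-self : ∀ i → i ⊕ i ≡ zero
⊕-self zero       = ≡.refl
⊕-self (suc zero) = ≡.refl

⊕≡zero⇒≡ : ∀ i j → i ⊕ j ≡ zero → i ≡ j
⊕≡zero⇒≡ zero       zero       _ = ≡.refl
⊕≡zero⇒≡ (suc zero) (suc zero) _ = ≡.refl

_^_ : ∀ {a} {A : Set a} → (A → A) → Fin 2 → A → A
(f ^ zero)     x = x
(f ^ suc zero) x = f x

module Powers {a ℓ} (S : Setoid a ℓ) where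
  open Setoid S

  ^-cong : ∀ {f} → (∀ {x y} → x ≈ y → f x ≈ f y) → ∀ i {x y} → x ≈ y → (f ^ i) x ≈ (f ^ i) y
  ^-cong f-cong zero       x≈y = x≈y
  ^-cong f-cong (suc zero) x≈y = f-cong x≈y

  ^-⊕ : ∀ {f} → (∀ x → f (f x) ≈ x) → ∀ i j x → (f ^ j) ((f ^ i) x) ≈ (f ^ (i ⊕ j)) x
  ^-⊕ f-invol zero       j          x = refl
  ^-⊕ f-invol (suc zero) zero       x = refl
  ^-⊕ f-invol (suc zero) (suc zero) x = f-invol x

  ^-comm : ∀ {f g} → (∀ x → f (g x) ≈ g (f x)) → ∀ i j x → (f ^ i) ((g ^ j) x) ≈ (g ^ j) ((f ^ i) x)
  ^-comm fg≈gf zero       j          x = refl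
  ^-comm fg≈gf (suc zero) zero       x = refl
  ^-comm fg≈gf (suc zero) (suc zero) x = fg≈gf x

module _ {a ℓ} (Γ : AbelianGroup a ℓ) where
  open AbelianGroup Γ renaming (Carrier to G)
  open import Algebra.Properties.AbelianGroup Γ using (⁻¹-∙-comm; xyx⁻¹≈y)
  open import Algebra.Properties.Group group
    using (⁻¹-involutive; inverseʳ-unique; inverseˡ-unique; identityˡ-unique; ε⁻¹≈ε; ⁻¹-injective)
  open import Algebra.Solver.CommutativeMonoid commutativeMonoid using (solve) renaming (_⊕_ to _⊕ₑ_; _⊜_ to _⊜ₑ_)
  open import Relation.Binary.Reasoning.Setoid setoid
  open Powers setoid

  Involution : G → Set ℓ
  Involution t = ¬ t ≈ ε × t ∙ t ≈ ε

  NonSquare : G → Set _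
  NonSquare x = ∀ y → ¬ y ∙ y ≈ x

  GoodPair : G → G → Set _
  GoodPair ω t = Involution t × NonSquare ω × NonSquare (ω ∙ t)

  square-∙ : ∀ x y → (x ∙ y) ∙ (x ∙ y) ≈ (x ∙ x) ∙ (y ∙ y)
  square-∙ = solve 2 (λ x y → (x ⊕ₑ y) ⊕ₑ (x ⊕ₑ y) ⊜ₑ (x ⊕ₑ x) ⊕ₑ (y ⊕ₑ y)) refl

  reflect : G → G → G
  reflect α y = α ∙ y ⁻¹

  reflect-cong : ∀ α {y z} → y ≈ z → reflect α y ≈ reflect α z
  reflect-cong α y≈z = ∙-congˡ (⁻¹-cong y≈z)

  reflect-partner : ∀ α y → y ∙ reflect α y ≈ α
  reflect-partner α y = begin
    y ∙ (α ∙ y ⁻¹)   ≈⟨ solve 3 (λ y α y′ → y ⊕ₑ (α ⊕ₑ y′) ⊜ₑ α ⊕ₑ (y ⊕ₑ y′)) refl y α (y ⁻¹) ⟩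
    α ∙ (y ∙ y ⁻¹)   ≈⟨ ∙-congˡ (inverseʳ y) ⟩
    α ∙ ε            ≈⟨ identityʳ α ⟩
    α                ∎

  reflect-fixed : ∀ α y → reflect α y ≈ y → y ∙ y ≈ α
  reflect-fixed α y eq = trans (∙-congˡ (sym eq)) (reflect-partner α y)

  reflect-reflect : ∀ α β y → reflect α (reflect β y) ≈ (α ∙ β ⁻¹) ∙ y
  reflect-reflect α β y = begin
    α ∙ (β ∙ y ⁻¹) ⁻¹        ≈⟨ ∙-congˡ (sym (⁻¹-∙-comm β (y ⁻¹))) ⟩
    α ∙ (β ⁻¹ ∙ y ⁻¹ ⁻¹)     ≈⟨ ∙-congˡ (∙-congˡ (⁻¹-involutive y)) ⟩
    α ∙ (β ⁻¹ ∙ y)           ≈⟨ sym (assoc α (β ⁻¹) y) ⟩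
    (α ∙ β ⁻¹) ∙ y           ∎

  reflect-involutive : ∀ α y → reflect α (reflect α y) ≈ y
  reflect-involutive α y = trans (reflect-reflect α α y) (trans (∙-congʳ (inverseʳ α)) (identityˡ y))

  self-inverse : ∀ {t} → t ∙ t ≈ ε → t ⁻¹ ≈ t
  self-inverse {t} t∙t≈ε = sym (inverseʳ-unique t t t∙t≈ε)

  reflect-square : ∀ α y → reflect α y ∙ reflect α y ≈ (α ∙ α) ∙ (y ∙ y) ⁻¹
  reflect-square α y = trans (square-∙ α (y ⁻¹)) (∙-congˡ (⁻¹-∙-comm y y))

  module KleinAction (α t : G) (t∙t≈ε : t ∙ t ≈ ε) where

    ρ κ : G → G
    ρ = reflect α
    κ = reflect (α ∙ t)

    Klein : Set
    Klein = Fin 2 × Fin 2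

    _⊞_ : Klein → Klein → Klein
    (i , j) ⊞ (i′ , j′) = i ⊕ i′ , j ⊕ j′

    act : G → Klein → G
    act y (i , j) = (κ ^ i) ((ρ ^ j) y)

    κρ≈t∙ : ∀ y → κ (ρ y) ≈ t ∙ y
    κρ≈t∙ y = trans (reflect-reflect (α ∙ t) α y) (∙-congʳ (xyx⁻¹≈y α t))

    ρκ≈κρ : ∀ y → ρ (κ y) ≈ κ (ρ y)
    ρκ≈κρ y = begin
      ρ (κ y)                     ≈⟨ reflect-reflect α (α ∙ t) y ⟩
      (α ∙ (α ∙ t) ⁻¹) ∙ y        ≈⟨ ∙-congʳ (∙-congˡ (sym (⁻¹-∙-comm α t))) ⟩
      (α ∙ (α ⁻¹ ∙ t ⁻¹)) ∙ y     ≈⟨ ∙-congʳ (sym (assoc α (α ⁻¹) (t ⁻¹))) ⟩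
      ((α ∙ α ⁻¹) ∙ t ⁻¹) ∙ y     ≈⟨ ∙-congʳ (trans (∙-cong (inverseʳ α) (self-inverse t∙t≈ε)) (identityˡ t)) ⟩
      t ∙ y                       ≈⟨ sym (κρ≈t∙ y) ⟩
      κ (ρ y)                     ∎

    act-cong : ∀ {x y} k → x ≈ y → act x k ≈ act y k
    act-cong (i , j) x≈y = ^-cong (reflect-cong (α ∙ t)) i (^-cong (reflect-cong α) j x≈y)

    act-⊞ : ∀ y k k′ → act (act y k) k′ ≈ act y (k ⊞ k′)
    act-⊞ y (i , j) (i′ , j′) = begin
      (κ ^ i′) ((ρ ^ j′) ((κ ^ i) ((ρ ^ j) y)))  ≈⟨ ^-cong (reflect-cong (α ∙ t)) i′ (^-comm ρκ≈κρ j′ i _) ⟩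
      (κ ^ i′) ((κ ^ i) ((ρ ^ j′) ((ρ ^ j) y)))  ≈⟨ ^-⊕ (reflect-involutive (α ∙ t)) i i′ _ ⟩
      (κ ^ (i ⊕ i′)) ((ρ ^ j′) ((ρ ^ j) y))
        ≈⟨ ^-cong (reflect-cong (α ∙ t)) (i ⊕ i′) (^-⊕ (reflect-involutive α) j j′ y) ⟩
      (κ ^ (i ⊕ i′)) ((ρ ^ (j ⊕ j′)) y)          ∎

    act-self : ∀ y k → act (act y k) k ≈ y
    act-self y k@(i , j) = trans (act-⊞ y k k) (reflexive (≡.cong₂ (λ i j → act y (i , j)) (⊕-self i) (⊕-self j)))

    act-fixed : ¬ t ≈ ε → ∀ y → ¬ y ∙ y ≈ α → ¬ y ∙ y ≈ α ∙ t →
                ∀ k → act y k ≈ y → k ≡ (zero , zero)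
    act-fixed t≉ε y ≉α ≉αt (zero     , zero)     _  = ≡.refl
    act-fixed t≉ε y ≉α ≉αt (zero     , suc zero) eq = contradiction (reflect-fixed α y eq) ≉α
    act-fixed t≉ε y ≉α ≉αt (suc zero , zero)     eq = contradiction (reflect-fixed (α ∙ t) y eq) ≉αt
    act-fixed t≉ε y ≉α ≉αt (suc zero , suc zero) eq =
      contradiction (identityˡ-unique t y (trans (sym (κρ≈t∙ y)) eq)) t≉ε

    act-free : ¬ t ≈ ε → ∀ y → ¬ y ∙ y ≈ α → ¬ y ∙ y ≈ α ∙ t →
               ∀ k k′ → act y k ≈ act y k′ → k ≡ k′
    act-free t≉ε y ≉α ≉αt k@(i , j) k′@(i′ , j′) eq
      with act-fixed t≉ε y ≉α ≉αt (k ⊞ k′)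
             (trans (sym (act-⊞ y k k′)) (trans (act-cong k′ eq) (act-self y k′)))
    ... | eq′ = ≡.cong₂ _,_ (⊕≡zero⇒≡ i i′ (≡.cong proj₁ eq′)) (⊕≡zero⇒≡ j j′ (≡.cong proj₂ eq′))

    act-rowPair : ∀ y i → act y (i , zero) ∙ act y (i , suc zero) ≈ α
    act-rowPair y i = trans (∙-congˡ (^-comm {f = κ} {g = ρ} (sym ∘ ρκ≈κρ) i (suc zero) y))
                            (reflect-partner α (act y (i , zero)))

    act-colPair : ∀ y j → act y (zero , j) ∙ act y (suc zero , j) ≈ α ∙ t
    act-colPair y j = reflect-partner (α ∙ t) (act y (zero , j))

    act-square : α ∙ α ≈ ε → ∀ y k → y ∙ y ≈ ε → act y k ∙ act y k ≈ ε
    act-square α∙α≈ε y (i , j) y∙y≈ε = squareκ i (squareρ j)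
      where
        reflect-square-ε : ∀ β z → β ∙ β ≈ ε → z ∙ z ≈ ε → reflect β z ∙ reflect β z ≈ ε
        reflect-square-ε β z β∙β≈ε z∙z≈ε =
          trans (reflect-square β z) (trans (∙-cong β∙β≈ε (trans (⁻¹-cong z∙z≈ε) ε⁻¹≈ε)) (identityˡ ε))
        αt∙αt≈ε : (α ∙ t) ∙ (α ∙ t) ≈ ε
        αt∙αt≈ε = trans (square-∙ α t) (trans (∙-cong α∙α≈ε t∙t≈ε) (identityˡ ε))
        squareρ : ∀ j → (ρ ^ j) y ∙ (ρ ^ j) y ≈ ε
        squareρ zero       = y∙y≈ε
        squareρ (suc zero) = reflect-square-ε α y α∙α≈ε y∙y≈ε
        squareκ : ∀ i {z} → z ∙ z ≈ ε → (κ ^ i) z ∙ (κ ^ i) z ≈ ε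
        squareκ zero       z∙z≈ε = z∙z≈ε
        squareκ (suc zero) z∙z≈ε = reflect-square-ε (α ∙ t) _ αt∙αt≈ε z∙z≈ε

    Fin4↔Klein : Fin 4 ↔ Klein
    Fin4↔Klein = *↔× {2} {2}

  -- Existence of a good pair

  involution-resp : ∀ {x y} → x ≈ y → Involution x → Involution y
  involution-resp x≈y (x≉ε , x∙x≈ε) =
    (λ y≈ε → x≉ε (trans x≈y y≈ε)) , trans (∙-cong (sym x≈y) (sym x≈y)) x∙x≈ε

  nonSquare-resp : ∀ {x y} → x ≈ y → NonSquare x → NonSquare y
  nonSquare-resp x≈y ns z z∙z≈y = ns z (trans z∙z≈y (sym x≈y))

  module _ {N : ℕ} (enum : HasOrder Γ N) where
    open FiniteSetoid setoid enum

    involution? : ∀ x → Dec (Involution x)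
    involution? x = ¬? (x ≟ ε) ×-dec ((x ∙ x) ≟ ε)

    square? : ∀ x → Dec (∃ λ y → y ∙ y ≈ x)
    square? x = any?ₛ (λ y≈z y∙y≈x → trans (∙-cong (sym y≈z) (sym y≈z)) y∙y≈x) (λ y → (y ∙ y) ≟ x)

    nonSquare? : ∀ x → Dec (NonSquare x)
    nonSquare? x = map′ (λ ¬sq y y∙y≈x → ¬sq (y , y∙y≈x)) (λ ns (y , y∙y≈x) → ns y y∙y≈x) (¬? (square? x))

    -- Inversion pairs off the non-involutions in Γ ∖ {ε}, whose size N - 1 is odd.
    involution-exists : ∀ K → N ≡ K * 2 → ∃ Involution
    involution-exists K N≡K*2 with any?ₛ involution-resp involution?
    ... | yes inv = inv
    ... | no ¬inv = ⊥-elim (r+q*d≢q′*d (Transversal.R T) K z<s (s≤s z<s)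
                      (≡.trans (≡.cong suc (transversal-size T)) (≡.trans (≡.sym N≡1+M) N≡K*2)))
      where
        M = proj₁ (inhabited⇒suc ε)
        N≡1+M = proj₂ (inhabited⇒suc ε)

        invert : Σ G (λ y → ¬ y ≈ ε) → Fin 2 → Σ G (λ y → ¬ y ≈ ε)
        invert (y , y≉ε) i = (_⁻¹ ^ i) y , ≉ε i
          where
            ≉ε : ∀ i → ¬ (_⁻¹ ^ i) y ≈ ε
            ≉ε zero       = y≉ε
            ≉ε (suc zero) y⁻¹≈ε = y≉ε (⁻¹-injective (trans y⁻¹≈ε (sym ε⁻¹≈ε)))

        fixed⇒involution : ∀ y → ¬ y ≈ ε → y ≈ y ⁻¹ → ⊥
        fixed⇒involution y y≉ε y≈y⁻¹ = ¬inv (y , y≉ε , trans (∙-congˡ y≈y⁻¹) (inverseʳ y))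

        invert-free : ∀ y i j → proj₁ (invert y i) ≈ proj₁ (invert y j) → i ≡ j
        invert-free y          zero       zero       _  = ≡.refl
        invert-free (y , y≉ε)  zero       (suc zero) eq = ⊥-elim (fixed⇒involution y y≉ε eq)
        invert-free (y , y≉ε)  (suc zero) zero       eq = ⊥-elim (fixed⇒involution y y≉ε (sym eq))
        invert-free y          (suc zero) (suc zero) _  = ≡.refl

        open FreeAction (setoid ∖ ε) (remove N≡1+M ε) ↔-refl invert

        T : Transversal
        T = transversal (λ i → ^-cong ⁻¹-cong i) (λ _ → zero , refl)
              (λ (y , _) i → i , trans (^-⊕ ⁻¹-involutive i i y) (reflexive (≡.cong (λ j → (_⁻¹ ^ j) y) (⊕-self i))))
              (λ (y , _) i j → i ⊕ j , ^-⊕ ⁻¹-involutive i j y)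
              invert-free

    nonSquare-exists : ∃ Involution → ∃ NonSquare
    nonSquare-exists (t , t≉ε , t∙t≈ε) with any?ₛ nonSquare-resp nonSquare?
    ... | yes nonSquare = nonSquare
    ... | no ¬nonSquare = ⊥-elim (t≉ε (sym (index-injective (surjective⇒injective square surjective _ _ ε²≡t²))))
      where
        square : Fin N → Fin N
        square i = index (enumerate i ∙ enumerate i)

        surjective : ∀ j → ∃ λ i → square i ≡ j
        surjective j with square? (enumerate j)
        ... | yes (y , y∙y≈) = index y , enumerate-injective _ _
                (trans (enumerate-index _) (trans (∙-cong (enumerate-index y) (enumerate-index y)) y∙y≈))
        ... | no ¬sq = ⊥-elim (¬nonSquare (enumerate j , λ y y∙y≈ → ¬sq (y , y∙y≈)))

        ε²≡t² : square (index ε) ≡ square (index t)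
        ε²≡t² = index-cong (begin
          enumerate (index ε) ∙ enumerate (index ε) ≈⟨ ∙-cong (enumerate-index ε) (enumerate-index ε) ⟩
          ε ∙ ε                                     ≈⟨ identityˡ ε ⟩
          ε                                         ≈⟨ t∙t≈ε ⟨
          t ∙ t                                     ≈⟨ ∙-cong (enumerate-index t) (enumerate-index t) ⟨
          enumerate (index t) ∙ enumerate (index t) ∎)

    -- The Klein action with α = ε moves Γ ∖ {ε, t} freely, so N - 2 is divisible by 4.
    uniqueInvolution⇒size≡2+4R : ∀ t → Involution t → NonSquare t → (∀ y → y ∙ y ≈ ε → y ≈ ε ⊎ y ≈ t) →
                            ∃ λ R → N ≡ 2 + R * 4
    uniqueInvolution⇒size≡2+4R t (t≉ε , t∙t≈ε) t-nonSquare twoTorsion =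
      R , ≡.trans N≡1+M₁ (≡.cong suc (≡.trans M₁≡1+M₂ (≡.cong suc (≡.sym (transversal-size T)))))
      where
        open KleinAction ε t t∙t≈ε

        M₁ = proj₁ (inhabited⇒suc ε)
        N≡1+M₁ = proj₂ (inhabited⇒suc ε)
        enum₁ = remove N≡1+M₁ ε
        t₁ : Σ G λ y → ¬ y ≈ ε
        t₁ = t , t≉ε
        open FiniteSetoid (setoid ∖ ε) enum₁ using () renaming (inhabited⇒suc to inhabited⇒suc₁; remove to remove₁)
        M₂ = proj₁ (inhabited⇒suc₁ t₁)
        M₁≡1+M₂ = proj₂ (inhabited⇒suc₁ t₁)

        Rest : Set _
        Rest = Σ (Σ G λ y → ¬ y ≈ ε) λ y → ¬ proj₁ y ≈ t

        element : Rest → G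
        element = proj₁ ∘ proj₁

        nonTorsion : ∀ y → ¬ element y ∙ element y ≈ ε
        nonTorsion ((y , y≉ε) , y≉t) y∙y≈ε with twoTorsion y y∙y≈ε
        ... | inj₁ y≈ε = y≉ε y≈ε
        ... | inj₂ y≈t = y≉t y≈t

        act′ : Rest → Klein → Rest
        act′ y k = (act (element y) k , λ eq → ¬torsion (trans (∙-cong eq eq) (identityˡ ε)))
                                      , λ eq → ¬torsion (trans (∙-cong eq eq) t∙t≈ε)
          where
            ¬torsion : ¬ act (element y) k ∙ act (element y) k ≈ ε
            ¬torsion sq = nonTorsion y (trans (∙-cong (sym (act-self _ k)) (sym (act-self _ k)))
                                              (act-square (identityˡ ε) _ k sq))

        open FreeAction ((setoid ∖ ε) ∖ t₁) (remove₁ M₁≡1+M₂ t₁) Fin4↔Klein act′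

        T : Transversal
        T = transversal act-cong (λ _ → (zero , zero) , refl) (λ y k → k , act-self (element y) k)
              (λ y k k′ → k ⊞ k′ , act-⊞ (element y) k k′)
              (λ y → act-free t≉ε (element y) (nonTorsion y)
                       (λ eq → t-nonSquare (element y) (trans eq (identityˡ t))))

        R = Transversal.R T

    goodPair-exists : ∀ K → N ≡ K * 4 → ∃₂ GoodPair
    goodPair-exists K N≡K*4 with any?ₛ (λ x≈y (inv , z , z∙z≈x) → involution-resp x≈y inv , z , trans z∙z≈x x≈y)
                                       (λ t → involution? t ×-dec square? t)
    ... | yes (t , inv , z , z∙z≈t) = ω , t , inv , ω-nonSquare , ωt-nonSquare
      where
        ω = proj₁ (nonSquare-exists (t , inv))
        ω-nonSquare = proj₂ (nonSquare-exists (t , inv))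
        ωt-nonSquare : NonSquare (ω ∙ t)
        ωt-nonSquare y y∙y≈ωt = ω-nonSquare (y ∙ z) (begin
          (y ∙ z) ∙ (y ∙ z)   ≈⟨ square-∙ y z ⟩
          (y ∙ y) ∙ (z ∙ z)   ≈⟨ ∙-cong y∙y≈ωt z∙z≈t ⟩
          (ω ∙ t) ∙ t         ≈⟨ assoc ω t t ⟩
          ω ∙ (t ∙ t)         ≈⟨ ∙-congˡ (proj₂ inv) ⟩
          ω ∙ ε               ≈⟨ identityʳ ω ⟩
          ω                   ∎)
    ... | no ¬squareInvolution with involution-exists (K * 2) (≡.trans N≡K*4 (≡.sym (*-assoc K 2 2)))
    ...   | t , inv with any?ₛ (λ x≈y (ns , ns′) → nonSquare-resp x≈y ns , nonSquare-resp (∙-congʳ x≈y) ns′)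
                               (λ ω → nonSquare? ω ×-dec nonSquare? (ω ∙ t))
    ...     | yes (ω , good) = ω , t , inv , good
    ...     | no ¬good = ⊥-elim (r+q*d≢q′*d R K z<s (s≤s (s≤s z<s)) (≡.trans (≡.sym N≡2+R*4) N≡K*4))
      where
        nonSquareInvolution : ∀ {y} → Involution y → NonSquare y
        nonSquareInvolution inv y z∙z≈y = ¬squareInvolution (_ , inv , y , z∙z≈y)

        twoTorsion : ∀ y → y ∙ y ≈ ε → y ≈ ε ⊎ y ≈ t
        twoTorsion y y∙y≈ε with y ≟ ε | y ≟ t
        ... | yes y≈ε | _       = inj₁ y≈ε
        ... | no _    | yes y≈t = inj₂ y≈t
        ... | no y≉ε  | no y≉t  = ⊥-elim (¬good (y , nonSquareInvolution (y≉ε , y∙y≈ε) , nonSquareInvolution yt-inv))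
          where
            yt-inv : Involution (y ∙ t)
            yt-inv = (λ yt≈ε → y≉t (trans (inverseˡ-unique y t yt≈ε) (self-inverse (proj₂ inv))))
                   , trans (square-∙ y t) (trans (∙-cong y∙y≈ε (proj₂ inv)) (identityˡ ε))

        R = proj₁ (uniqueInvolution⇒size≡2+4R t inv (nonSquareInvolution inv) twoTorsion)
        N≡2+R*4 = proj₂ (uniqueInvolution⇒size≡2+4R t inv (nonSquareInvolution inv) twoTorsion)

-- Layout of the labels in the arrays

module Layout {m n s k : ℕ} .{{_ : NonZero s}} .{{_ : NonZero n}} (s≤n : s ≤ n) (ms≡nk : m * s ≡ n * k) where

  row : Fin (m * s) → Fin m
  row p = fromℕ< (m<n*o⇒m/o<n (toℕ<n p))

  column : Fin (m * s) → Fin n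
  column p = toℕ p mod n

  position : Fin (m * s) → Fin m × Fin n
  position p = row p , column p

  position-injective : ∀ {p p′} → position p ≡ position p′ → p ≡ p′
  position-injective eq = toℕ-injective (/-%-injective s≤n
    (≡.trans (≡.sym (toℕ-fromℕ< _)) (≡.trans (≡.cong (toℕ ∘ proj₁) eq) (toℕ-fromℕ< _)))
    (≡.trans (≡.sym (toℕ-fromℕ< _)) (≡.trans (≡.cong (toℕ ∘ proj₂) eq) (toℕ-fromℕ< _))))

  cell : Fin m → Fin n → Maybe (Fin (m * s))
  cell i j = preimage (≡-dec _≟ᶠ_ _≟ᶠ_) position (i , j)

  cell-position : ∀ p → cell (row p) (column p) ≡ just p
  cell-position = preimage-complete (≡-dec _≟ᶠ_ _≟ᶠ_) position position-injective

  cell-sound : ∀ {i j p} → cell i j ≡ just p → row p ≡ i × column p ≡ j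
  cell-sound eq = let e = preimage-sound (≡-dec _≟ᶠ_ _≟ᶠ_) position eq in ≡.cong proj₁ e , ≡.cong proj₂ e

  toℕ-combine′ : ∀ (i : Fin m) (u : Fin s) → toℕ (combine i u) ≡ toℕ u + toℕ i * s
  toℕ-combine′ i u = ≡.trans (toℕ-combine i u) (≡.trans (+-comm _ (toℕ u)) (≡.cong (toℕ u +_) (*-comm s (toℕ i))))

  row-combine : ∀ i u → row (combine i u) ≡ i
  row-combine i u = toℕ-injective (≡.trans (toℕ-fromℕ< _)
    (≡.trans (≡.cong (_/ s) (toℕ-combine′ i u)) ([r+q*d]/d≡q (toℕ i) (toℕ<n u))))

  rowColumn : Fin m → Fin s → Fin n
  rowColumn i u = column (combine i u)

  cell-rowColumn : ∀ i u → cell i (rowColumn i u) ≡ just (combine i u)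
  cell-rowColumn i u = ≡.subst (λ r → cell r (rowColumn i u) ≡ just (combine i u)) (row-combine i u) (cell-position _)

  rowColumn-injective : ∀ i {u u′} → rowColumn i u ≡ rowColumn i u′ → u ≡ u′
  rowColumn-injective i {u} {u′} eq = combine-injectiveʳ i u i u′
    (position-injective (≡.cong₂ _,_ (≡.trans (row-combine i u) (≡.sym (row-combine i u′))) eq))

  row-labels : ∀ {i j p} → cell i j ≡ just p → ∃ λ u → rowColumn i u ≡ j
  row-labels {i} {p = p} eq with cell-sound eq
  ... | row≡i , column≡j = toℕ p mod s , ≡.trans (≡.cong column p≡) column≡j
    where
      p≡ : combine i (toℕ p mod s) ≡ p
      p≡ = toℕ-injective (≡.trans (toℕ-combine′ i _)
             (≡.trans (≡.cong (λ r → toℕ (toℕ p mod s) + r * s) (≡.trans (≡.sym (≡.cong toℕ row≡i)) (toℕ-fromℕ< _)))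
                      (toℕ-mod+div (toℕ p))))

  columnLabel : Fin n → Fin k → Fin (m * s)
  columnLabel j l = fromℕ< (≡.subst (toℕ j + toℕ l * n <_) (≡.trans (*-comm k n) (≡.sym ms≡nk))
                              (r+q*d<Q*d (toℕ<n j) (toℕ<n l)))

  toℕ-columnLabel : ∀ j l → toℕ (columnLabel j l) ≡ toℕ j + toℕ l * n
  toℕ-columnLabel j l = toℕ-fromℕ< _

  column-columnLabel : ∀ j l → column (columnLabel j l) ≡ j
  column-columnLabel j l = ≡.trans (≡.cong (_mod n) (toℕ-columnLabel j l)) ([r+q*d]mod-d≡r j (toℕ l))

  columnRow : Fin n → Fin k → Fin m
  columnRow j l = row (columnLabel j l)

  cell-columnRow : ∀ j l → cell (columnRow j l) j ≡ just (columnLabel j l)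
  cell-columnRow j l = ≡.subst (λ c → cell (columnRow j l) c ≡ just (columnLabel j l)) (column-columnLabel j l) (cell-position _)

  columnRow-injective : ∀ j {l l′} → columnRow j l ≡ columnRow j l′ → l ≡ l′
  columnRow-injective j {l} {l′} eq = toℕ-injective (*-cancelʳ-≡ (toℕ l) (toℕ l′) n (+-cancelˡ-≡ (toℕ j) _ _
    (≡.trans (≡.sym (toℕ-columnLabel j l)) (≡.trans (≡.cong toℕ same-label) (toℕ-columnLabel j l′)))))
    where
      same-label : columnLabel j l ≡ columnLabel j l′
      same-label = position-injective (≡.cong₂ _,_ eq (≡.trans (column-columnLabel j l) (≡.sym (column-columnLabel j l′))))

  column-labels : ∀ {i j p} → cell i j ≡ just p → ∃ λ l → columnRow j l ≡ i
  column-labels {j = j} {p} eq with cell-sound eq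
  ... | row≡i , column≡j = fromℕ< l<k , ≡.trans (≡.cong row p≡) row≡i
    where
      l<k : toℕ p / n < k
      l<k = m<n*o⇒m/o<n (≡.subst (toℕ p <_) (≡.trans ms≡nk (*-comm n k)) (toℕ<n p))
      p≡ : columnLabel j (fromℕ< l<k) ≡ p
      p≡ = toℕ-injective (≡.trans (toℕ-columnLabel j (fromℕ< l<k))
             (≡.trans (≡.cong₂ (λ c l → toℕ c + l * n) (≡.sym column≡j) (toℕ-fromℕ< l<k)) (toℕ-mod+div (toℕ p))))

module LayoutSums {m n s k : ℕ} .{{_ : NonZero s}} .{{_ : NonZero n}} (s≤n : s ≤ n) (ms≡nk : m * s ≡ n * k)
                  {c ℓ} (M : CommutativeMonoid c ℓ) (g : Fin (m * s) → CommutativeMonoid.Carrier M) where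
  open Layout {m} {n} {s} {k} s≤n ms≡nk
  open CommutativeMonoid M
  open FiniteSums M

  entry : Fin m → Fin n → Carrier
  entry i j = fromMaybe ε (map g (cell i j))

  row-sum : ∀ i → sum (entry i) ≈ sum (λ u → g (combine i u))
  row-sum i = trans (sum-reindex (entry i) (rowColumn i) (rowColumn-injective i) vanish)
                    (reflexive (sum-cong-≗ (≡.cong (fromMaybe ε ∘ map g) ∘ cell-rowColumn i)))
    where
      vanish : ∀ j → (∀ u → rowColumn i u ≢ j) → entry i j ≈ ε
      vanish j j∉ with cell i j in eq
      ... | nothing = refl
      ... | just p  = let u , eq′ = row-labels eq in ⊥-elim (j∉ u eq′)

  column-sum : ∀ j → sum (λ i → entry i j) ≈ sum (λ l → g (columnLabel j l))
  column-sum j = trans (sum-reindex (λ i → entry i j) (columnRow j) (columnRow-injective j) vanish)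
                       (reflexive (sum-cong-≗ (≡.cong (fromMaybe ε ∘ map g) ∘ cell-columnRow j)))
    where
      vanish : ∀ i → (∀ l → columnRow j l ≢ i) → entry i j ≈ ε
      vanish i i∉ with cell i j in eq
      ... | nothing = refl
      ... | just p  = let l , eq′ = column-labels eq in ⊥-elim (i∉ l eq′)

module _ {a ℓ} (Γ : AbelianGroup a ℓ) where
  open AbelianGroup Γ renaming (Carrier to G)
  open FiniteSums commutativeMonoid using (sum; sum-cong-≗; ∑ℕ; sum-toℕ)
  open import Relation.Binary.Reasoning.Setoid setoid

  module LabelledArrays {m n s k c : ℕ} .{{_ : NonZero m}} .{{_ : NonZero s}} .{{_ : NonZero n}}
    (s≤n : s ≤ n) (ms≡nk : m * s ≡ n * k) (value : ℕ → G)
    (value-injective : ∀ {P P′} → P < c * (m * s) → P′ < c * (m * s) → value P ≈ value P′ → P ≡ P′)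
    (value-surjective : ∀ g → ∃ λ P → P < c * (m * s) × value P ≈ g)
    (ω δ : G)
    (row-sums : ∀ (t : Fin c) (i : Fin m) → ∑ℕ s (λ u → value ((u + toℕ i * s) + toℕ t * (m * s))) ≈ ω)
    (column-sums : ∀ (t : Fin c) (j : Fin n) → ∑ℕ k (λ l → value ((toℕ j + l * n) + toℕ t * (m * s))) ≈ δ)
    where

    open Layout {m} {n} {s} {k} s≤n ms≡nk

    private instance
      nonZero-ms : NonZero (m * s)
      nonZero-ms = m*n≢0 m s

    label : Fin c → Fin (m * s) → ℕ
    label t p = toℕ p + toℕ t * (m * s)

    label< : ∀ t p → label t p < c * (m * s)
    label< t p = r+q*d<Q*d (toℕ<n p) (toℕ<n t)

    A : Fin c → PArray Γ m n
    A t i j = map (value ∘ label t) (cell i j)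

    covers : ∀ g → ∃ λ t → ∃ λ i → ∃ λ j → ∃ λ x → A t i j ≡ just x × x ≈ g
    covers g with value-surjective g
    ... | P , P< , P↦g = t , row p , column p , value (label t p) ,
                         ≡.cong (map (value ∘ label t)) (cell-position p) ,
                         trans (reflexive (≡.cong value label≡P)) P↦g
      where
        t/P<c = m<n*o⇒m/o<n {P} {c} {m * s} P<
        t = fromℕ< t/P<c
        p = P mod (m * s)
        label≡P : label t p ≡ P
        label≡P = ≡.trans (≡.cong (λ q → toℕ p + q * (m * s)) (toℕ-fromℕ< t/P<c)) (toℕ-mod+div {m * s} P)

    unique : ∀ t i j t′ i′ j′ x y → A t i j ≡ just x → A t′ i′ j′ ≡ just y →
             x ≈ y → t ≡ t′ × i ≡ i′ × j ≡ j′
    unique t i j t′ i′ j′ x y A≡x A≡y x≈y with cell i j in eq | cell i′ j′ in eq′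
    unique t i j t′ i′ j′ _ _ ≡.refl ≡.refl x≈y | just p | just p′ =
      t≡t′ , ≡.trans (≡.sym (proj₁ (cell-sound eq))) (≡.trans (≡.cong row p≡p′) (proj₁ (cell-sound eq′))) ,
             ≡.trans (≡.sym (proj₂ (cell-sound eq))) (≡.trans (≡.cong column p≡p′) (proj₂ (cell-sound eq′)))
      where
        same-label : label t p ≡ label t′ p′
        same-label = value-injective (label< t p) (label< t′ p′) x≈y
        p≡p′ : p ≡ p′
        p≡p′ = toℕ-injective (≡.trans (≡.sym ([r+q*d]%d≡r (toℕ t) (toℕ<n p)))
                 (≡.trans (≡.cong (_% (m * s)) same-label) ([r+q*d]%d≡r (toℕ t′) (toℕ<n p′))))
        t≡t′ : t ≡ t′
        t≡t′ = toℕ-injective (≡.trans (≡.sym ([r+q*d]/d≡q (toℕ t) (toℕ<n p)))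
                 (≡.trans (≡.cong (_/ (m * s)) same-label) ([r+q*d]/d≡q (toℕ t′) (toℕ<n p′))))

    indicator≡ : ∀ t mp → (if is-just (map (value ∘ label t) mp) then 1 else 0) ≡ fromMaybe 0 (map (λ _ → 1) mp)
    indicator≡ t (just _) = ≡.refl
    indicator≡ t nothing  = ≡.refl

    sum-ones : ∀ r → FiniteSums.sum +-0-commutativeMonoid {r} (λ _ → 1) ≡ r
    sum-ones zero    = ≡.refl
    sum-ones (suc r) = ≡.cong suc (sum-ones r)

    module Counts = LayoutSums {m} {n} {s} {k} s≤n ms≡nk +-0-commutativeMonoid (λ _ → 1)
    module Values (t : Fin c) = LayoutSums {m} {n} {s} {k} s≤n ms≡nk commutativeMonoid (value ∘ label t)

    rowFill : ∀ t i → count (λ j → is-just (A t i j)) ≡ s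
    rowFill t i = ≡.trans (count≡sum (λ j → is-just (A t i j)))
      (≡.trans (FiniteSums.sum-cong-≗ +-0-commutativeMonoid (indicator≡ t ∘ cell i))
               (≡.trans (Counts.row-sum i) (sum-ones s)))

    colFill : ∀ t j → count (λ i → is-just (A t i j)) ≡ k
    colFill t j = ≡.trans (count≡sum (λ i → is-just (A t i j)))
      (≡.trans (FiniteSums.sum-cong-≗ +-0-commutativeMonoid (λ i → indicator≡ t (cell i j)))
               (≡.trans (Counts.column-sum j) (sum-ones k)))

    rowSum : ∀ t i → gsum Γ (λ j → fromMaybe ε (A t i j)) ≈ ω
    rowSum t i = begin
      gsum Γ (Values.entry t i)                    ≡⟨ gsum≡sum Γ (Values.entry t i) ⟩
      sum (Values.entry t i)                       ≈⟨ Values.row-sum t i ⟩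
      sum {s} (λ u → value (label t (combine i u)))
        ≡⟨ sum-cong-≗ (≡.cong (λ r → value (r + toℕ t * (m * s))) ∘ toℕ-combine′ i) ⟩
      sum {s} (F ∘ toℕ)                            ≡⟨ sum-toℕ s F ⟩
      ∑ℕ s F                                       ≈⟨ row-sums t i ⟩
      ω                                            ∎
      where
        F : ℕ → G
        F u = value ((u + toℕ i * s) + toℕ t * (m * s))

    colSum : ∀ t j → gsum Γ (λ i → fromMaybe ε (A t i j)) ≈ δ
    colSum t j = begin
      gsum Γ (λ i → Values.entry t i j)            ≡⟨ gsum≡sum Γ (λ i → Values.entry t i j) ⟩
      sum (λ i → Values.entry t i j)               ≈⟨ Values.column-sum t j ⟩
      sum {k} (λ l → value (label t (columnLabel j l)))
        ≡⟨ sum-cong-≗ (≡.cong (λ r → value (r + toℕ t * (m * s))) ∘ toℕ-columnLabel j) ⟩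
      sum {k} (F ∘ toℕ)                            ≡⟨ sum-toℕ k F ⟩
      ∑ℕ k F                                       ≈⟨ column-sums t j ⟩
      δ                                            ∎
      where
        F : ℕ → G
        F l = value ((toℕ j + l * n) + toℕ t * (m * s))

    mrs : MRS Γ m n s k c
    mrs = record { A = A ; covers = covers ; unique = unique ; rowFill = rowFill ; colFill = colFill
                 ; ω = ω ; δ = δ ; rowSum = rowSum ; colSum = colSum }
-- Assigning group elements to labels

module _ {ℓ₁ ℓ₂} (Γ : AbelianGroup ℓ₁ ℓ₂) where
  open AbelianGroup Γ renaming (Carrier to G)

  -- Label P = b + 2 (x + w (a + 2 y)) is sent to the Klein element (a , b) applied to the
  -- representative of orbit x + w y, so flipping b (P ↔ P + 1) gives ρ-partners and flipping a
  -- (P ↔ P + 2w) gives κ-partners.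
  module Labelling {N : ℕ} (enum : HasOrder Γ N) {ω t : G} (good : GoodPair Γ ω t)
                   (w M : ℕ) .{{_ : NonZero w}} .{{_ : NonZero M}} (N≡M*w*4 : N ≡ M * w * 4) where

    open KleinAction Γ ω t (proj₂ (proj₁ good))
    open FreeAction setoid enum Fin4↔Klein act

    T : Transversal
    T = transversal act-cong (λ _ → (zero , zero) , refl) (λ y k → k , act-self y k)
          (λ y k k′ → k ⊞ k′ , act-⊞ y k k′)
          (λ y → act-free (proj₁ (proj₁ good)) y (proj₁ (proj₂ good) y) (proj₂ (proj₂ good) y))

    open Transversal T

    R≡M*w : R ≡ M * w
    R≡M*w = *-cancelʳ-≡ R (M * w) 4 (≡.trans (transversal-size T) N≡M*w*4)

    private instance
      nonZero-R : NonZero R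
      nonZero-R = ≡.subst NonZero (≡.sym R≡M*w) (m*n≢0 M w)

    orbitNumber : ℕ → ℕ
    orbitNumber H = toℕ (H mod w) + H / w / 2 * w

    halfLabelValue : ℕ → Fin 2 → G
    halfLabelValue H b = act (rep (orbitNumber H mod R)) ((H / w) mod 2 , b)

    value : ℕ → G
    value P = halfLabelValue (P / 2) (P mod 2)

    value-half : ∀ b H → value (toℕ b + H * 2) ≡ halfLabelValue H b
    value-half b H = ≡.cong₂ halfLabelValue ([r+q*d]/d≡q H (toℕ<n b)) ([r+q*d]mod-d≡r b H)

    halfLabelValue-digits : ∀ {x} a y b → x < w →
                            halfLabelValue (x + (toℕ a + y * 2) * w) b ≡ act (rep ((x + y * w) mod R)) (a , b)
    halfLabelValue-digits {x} a y b x<w = ≡.cong₂ (λ q a → act (rep (q mod R)) (a , b))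
      (≡.cong₂ (λ x y → x + y * w) x≡ (≡.trans (≡.cong (_/ 2) H/w≡) ([r+q*d]/d≡q y (toℕ<n a))))
      (≡.trans (≡.cong (_mod 2) H/w≡) ([r+q*d]mod-d≡r a y))
      where
        H/w≡ : (x + (toℕ a + y * 2) * w) / w ≡ toℕ a + y * 2
        H/w≡ = [r+q*d]/d≡q (toℕ a + y * 2) x<w
        x≡ : toℕ ((x + (toℕ a + y * 2) * w) mod w) ≡ x
        x≡ = ≡.trans (toℕ-fromℕ< _) ([r+q*d]%d≡r (toℕ a + y * 2) x<w)

    value-rowPair : ∀ z → value (z * 2) ∙ value (1 + z * 2) ≈ ω
    value-rowPair z = trans (reflexive (≡.cong₂ _∙_ (value-half zero z) (value-half (suc zero) z)))
                        (act-rowPair (rep (orbitNumber z mod R)) ((z / w) mod 2))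

    value-columnPair : ∀ r z → r < w * 2 → value (r + z * (w * 4)) ∙ value (r + w * 2 + z * (w * 4)) ≈ ω ∙ t
    value-columnPair r z r<2w = begin
      value (r + z * (w * 4)) ∙ value (r + w * 2 + z * (w * 4))
        ≡⟨ ≡.cong₂ (λ P P′ → value P ∙ value P′) (≡.trans (≡.cong (_+ z * (w * 4)) r≡) (digits₀ (toℕ b) x z w))
                                         (≡.trans (≡.cong (λ r → r + w * 2 + z * (w * 4)) r≡) (digits₁ (toℕ b) x z w)) ⟩
      value (toℕ b + (x + (0 + z * 2) * w) * 2) ∙ value (toℕ b + (x + (1 + z * 2) * w) * 2)
        ≡⟨ ≡.cong₂ _∙_ (≡.trans (value-half b _) (halfLabelValue-digits zero z b x<w))
                       (≡.trans (value-half b _) (halfLabelValue-digits (suc zero) z b x<w)) ⟩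
      act (rep ((x + z * w) mod R)) (zero , b) ∙ act (rep ((x + z * w) mod R)) (suc zero , b)
        ≈⟨ act-colPair _ b ⟩
      ω ∙ t ∎
      where
        open import Relation.Binary.Reasoning.Setoid setoid
        b = r mod 2
        x = r / 2
        x<w : x < w
        x<w = m<n*o⇒m/o<n r<2w
        r≡ : r ≡ toℕ b + x * 2
        r≡ = ≡.sym (toℕ-mod+div {2} r)
        digits₀ : ∀ b x z w → b + x * 2 + z * (w * 4) ≡ b + (x + (0 + z * 2) * w) * 2
        digits₀ = solve-∀
        digits₁ : ∀ b x z w → b + x * 2 + w * 2 + z * (w * 4) ≡ b + (x + (1 + z * 2) * w) * 2
        digits₁ = solve-∀

    orbitNumber< : ∀ {H} → H < M * w * 2 → orbitNumber H < R
    orbitNumber< {H} H< = ≡.subst (orbitNumber H <_) (≡.sym R≡M*w)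
      (r+q*d<Q*d (toℕ<n (H mod w)) (m<n*o⇒m/o<n {H / w} {M} {2}
        (m<n*o⇒m/o<n {H} {M * 2} {w} (≡.subst (H <_) (M*w*2≡M*2*w M w) H<))))
      where
        M*w*2≡M*2*w : ∀ M w → M * w * 2 ≡ M * 2 * w
        M*w*2≡M*2*w = solve-∀

    half< : ∀ {P} → P < N → P / 2 < M * w * 2
    half< {P} P<N = m<n*o⇒m/o<n {P} {M * w * 2} {2}
      (≡.subst (P <_) (≡.trans N≡M*w*4 (≡.sym (*-assoc (M * w) 2 2))) P<N)

    value-injective : ∀ {P P′} → P < N → P′ < N → value P ≈ value P′ → P ≡ P′
    value-injective {P} {P′} P<N P′<N eq = mod-div-injective (≡.cong proj₂ same-klein) H≡H′
      where
        H = P / 2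
        H′ = P′ / 2
        same = rep-unique (orbitNumber H mod R) (orbitNumber H′ mod R) ((H / w) mod 2 , P mod 2) ((H′ / w) mod 2 , P′ mod 2) eq
        same-orbit = proj₁ same
        same-klein = proj₂ same
        same-number : orbitNumber H ≡ orbitNumber H′
        same-number = ≡.trans (≡.sym (m<n⇒m%n≡m (orbitNumber< (half< P<N))))
          (≡.trans (≡.sym (toℕ-fromℕ< _)) (≡.trans (≡.cong toℕ same-orbit)
            (≡.trans (toℕ-fromℕ< _) (m<n⇒m%n≡m (orbitNumber< (half< P′<N))))))
        H≡H′ : H ≡ H′
        H≡H′ = mod-div-injective
          (toℕ-injective (≡.trans (≡.sym ([r+q*d]%d≡r (H / w / 2) (toℕ<n (H mod w))))
            (≡.trans (≡.cong (_% w) same-number) ([r+q*d]%d≡r (H′ / w / 2) (toℕ<n (H′ mod w))))))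
          (mod-div-injective (≡.cong proj₁ same-klein)
            (≡.trans (≡.sym ([r+q*d]/d≡q (H / w / 2) (toℕ<n (H mod w))))
              (≡.trans (≡.cong (_/ w) same-number) ([r+q*d]/d≡q (H′ / w / 2) (toℕ<n (H′ mod w))))))

    value-surjective : ∀ g → ∃ λ P → P < N × value P ≈ g
    value-surjective g = P , P<N , trans (reflexive value≡) (proj₂ (proj₂ (rep-cover g)))
      where
        q = proj₁ (rep-cover g)
        a = proj₁ (proj₁ (proj₂ (rep-cover g)))
        b = proj₂ (proj₁ (proj₂ (rep-cover g)))
        x = toℕ q mod w
        y = toℕ q / w
        P = toℕ b + (toℕ x + (toℕ a + y * 2) * w) * 2

        y<M : y < M
        y<M = m<n*o⇒m/o<n (≡.subst (toℕ q <_) R≡M*w (toℕ<n q))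

        P<N : P < N
        P<N = ≡.subst (P <_) (≡.trans (size M w) (≡.sym N≡M*w*4))
                (r+q*d<Q*d (toℕ<n b) (r+q*d<Q*d (toℕ<n x) (r+q*d<Q*d (toℕ<n a) y<M)))
          where
            size : ∀ M w → M * 2 * w * 2 ≡ M * w * 4
            size = solve-∀

        value≡ : value P ≡ act (rep q) (a , b)
        value≡ = ≡.trans (value-half b _) (≡.trans (halfLabelValue-digits a y b (toℕ<n x))
               (≡.cong (λ i → act (rep i) (a , b)) (≡.trans (≡.cong (_mod R) (toℕ-mod+div (toℕ q))) (toℕ[i]mod-d≡i q))))


    open FiniteSums commutativeMonoid using (∑ℕ; ∑ℕ-pairs; _·_)

    value-rows : ∀ S B → ∑ℕ (S * 2) (λ u → value (u + B * 2)) ≈ S · ω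
    value-rows S B = trans (∑ℕ-pairs S 1 _ λ { z zero _ → pair z ; z (suc _) (s≤s ()) })
                           (reflexive (≡.cong (_· ω) (*-identityʳ S)))
      where
        regroup : ∀ b z B → z * 2 + b + B * 2 ≡ b + (z + B) * 2
        regroup = solve-∀
        pair : ∀ z → value (z * 2 + 0 + B * 2) ∙ value (z * 2 + 1 + B * 2) ≈ ω
        pair z = trans (reflexive (≡.cong₂ (λ P P′ → value P ∙ value P′) (regroup 0 z B) (regroup 1 z B)))
                       (value-rowPair (z + B))

    value-columns : ∀ {n} h Y B {j} → n * h ≡ w * 2 → j < n →
                    ∑ℕ (Y * (h + h)) (λ l → value (j + l * n + B * (w * 4))) ≈ (Y * h) · (ω ∙ t)
    value-columns {n} h Y B {j} nh≡w*2 j<n = ∑ℕ-pairs Y h _ pair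
      where
        instance
          nonZero-n : NonZero n
          nonZero-n = >-nonZero (≤-trans (s≤s z≤n) j<n)
        4w≡ : n * h * 2 ≡ w * 4
        4w≡ = ≡.trans (≡.cong (_* 2) nh≡w*2) (*-assoc w 2 2)
        hn≡2w : h * n ≡ w * 2
        hn≡2w = ≡.trans (*-comm h n) nh≡w*2
        regroup : ∀ j z h d i n B → j + (z * (h + h) + (d + i)) * n + B * (n * h * 2)
                                    ≡ j + i * n + d * n + (z + B) * (n * h * 2)
        regroup = solve-∀
        offset : ∀ z i d → j + (z * (h + h) + (d + i)) * n + B * (w * 4) ≡ j + i * n + d * n + (z + B) * (w * 4)
        offset z i d = ≡.trans (≡.cong (λ x → j + (z * (h + h) + (d + i)) * n + B * x) (≡.sym 4w≡))
                         (≡.trans (regroup j z h d i n B) (≡.cong (λ x → j + i * n + d * n + (z + B) * x) 4w≡))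
        pair : ∀ z i → i < h → value (j + (z * (h + h) + i) * n + B * (w * 4))
                               ∙ value (j + (z * (h + h) + (h + i)) * n + B * (w * 4)) ≈ ω ∙ t
        pair z i i<h = trans (reflexive (≡.cong₂ (λ P P′ → value P ∙ value P′)
            (≡.trans (offset z i 0) (≡.cong (_+ (z + B) * (w * 4)) (+-identityʳ (j + i * n))))
            (≡.trans (offset z i h) (≡.cong (λ x → j + i * n + x + (z + B) * (w * 4)) hn≡2w))))
          (value-columnPair (j + i * n) (z + B) (≡.subst (j + i * n <_) hn≡2w (r+q*d<Q*d j<n i<h)))

  open FiniteSums commutativeMonoid using (∑ℕ; ∑ℕ-cong; _·_)

  mrs-from-factorisation : ∀ {m n s k c} .{{_ : NonZero m}} .{{_ : NonZero s}} .{{_ : NonZero n}} .{{_ : NonZero c}} →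
                           s ≤ n → m * s ≡ n * k → HasOrder Γ (n * k * c) →
                           ∀ S h w Y .{{_ : NonZero w}} .{{_ : NonZero Y}} →
                           s ≡ S * 2 → n * h ≡ w * 2 → k ≡ Y * (h + h) → MRS Γ m n s k c
  mrs-from-factorisation {m} {n} {s} {k} {c} s≤n ms≡nk enum S h w Y s≡S*2 nh≡w*2 k≡Y*2h =
    LabelledArrays.mrs Γ s≤n ms≡nk value value-injective value-surjective (S · ω) ((Y * h) · (ω ∙ τ)) row-sums column-sums
    where
      open import Relation.Binary.Reasoning.Setoid setoid

      instance
        nonZero-Yc : NonZero (Y * c)
        nonZero-Yc = m*n≢0 Y c

      ms≡Y*4w : m * s ≡ Y * (w * 4)
      ms≡Y*4w = ≡.trans ms≡nk (≡.trans (≡.cong (n *_) k≡Y*2h) (≡.trans (regroup n Y h)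
                  (≡.trans (≡.cong (λ x → Y * (x * 2)) nh≡w*2) (≡.cong (Y *_) (*-assoc w 2 2)))))
        where
          regroup : ∀ n Y h → n * (Y * (h + h)) ≡ Y * (n * h * 2)
          regroup = solve-∀

      enum′ : HasOrder Γ (c * (m * s))
      enum′ = ≡.subst (HasOrder Γ) (≡.trans (*-comm (n * k) c) (≡.cong (c *_) (≡.sym ms≡nk))) enum

      N≡Yc*w*4 : c * (m * s) ≡ Y * c * w * 4
      N≡Yc*w*4 = ≡.trans (≡.cong (c *_) ms≡Y*4w) (regroup Y w c)
        where
          regroup : ∀ Y w c → c * (Y * (w * 4)) ≡ Y * c * w * 4
          regroup = solve-∀

      good = goodPair-exists Γ enum′ (Y * c * w) N≡Yc*w*4
      ω = proj₁ good
      τ = proj₁ (proj₂ good)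

      open Labelling enum′ (proj₂ (proj₂ good)) w (Y * c) N≡Yc*w*4

      row-sums : ∀ (t : Fin c) (i : Fin m) → ∑ℕ s (λ u → value ((u + toℕ i * s) + toℕ t * (m * s))) ≈ S · ω
      row-sums t i = begin
        ∑ℕ s F                                  ≡⟨ ≡.cong (λ x → ∑ℕ x F) s≡S*2 ⟩
        ∑ℕ (S * 2) F                            ≈⟨ ∑ℕ-cong (S * 2) (reflexive ∘ ≡.cong value ∘ row-label) ⟩
        ∑ℕ (S * 2) (λ u → value (u + B * 2))    ≈⟨ value-rows S B ⟩
        S · ω                                   ∎
        where
          F : ℕ → G
          F u = value ((u + toℕ i * s) + toℕ t * (m * s))
          B = toℕ i * S + toℕ t * (m * S)
          regroup : ∀ u i t m S → u + i * (S * 2) + t * (m * (S * 2)) ≡ u + (i * S + t * (m * S)) * 2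
          regroup = solve-∀
          row-label : ∀ u → (u + toℕ i * s) + toℕ t * (m * s) ≡ u + B * 2
          row-label u = ≡.trans (≡.cong (λ s → (u + toℕ i * s) + toℕ t * (m * s)) s≡S*2) (regroup u (toℕ i) (toℕ t) m S)

      column-sums : ∀ (t : Fin c) (j : Fin n) →
                    ∑ℕ k (λ l → value ((toℕ j + l * n) + toℕ t * (m * s))) ≈ (Y * h) · (ω ∙ τ)
      column-sums t j = begin
        ∑ℕ k F
          ≡⟨ ≡.cong (λ x → ∑ℕ x F) k≡Y*2h ⟩
        ∑ℕ (Y * (h + h)) F
          ≈⟨ ∑ℕ-cong (Y * (h + h)) (reflexive ∘ ≡.cong value ∘ column-label) ⟩
        ∑ℕ (Y * (h + h)) (λ l → value (toℕ j + l * n + toℕ t * Y * (w * 4)))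
          ≈⟨ value-columns h Y (toℕ t * Y) nh≡w*2 (toℕ<n j) ⟩
        (Y * h) · (ω ∙ τ)
          ∎
        where
          F : ℕ → G
          F l = value ((toℕ j + l * n) + toℕ t * (m * s))
          column-label : ∀ l → (toℕ j + l * n) + toℕ t * (m * s) ≡ toℕ j + l * n + toℕ t * Y * (w * 4)
          column-label l = ≡.cong (toℕ j + l * n +_)
            (≡.trans (≡.cong (toℕ t *_) ms≡Y*4w) (≡.sym (*-assoc (toℕ t) Y (w * 4))))
-- Case analysis on residues mod 4

nonZero-factor : ∀ {x} Y d → x ≡ Y * d → 2 ≤ x → NonZero Y
nonZero-factor zero    d ≡.refl ()
nonZero-factor (suc Y) d _      _ = _

even-from-mod4 : ∀ x → x % 4 ≡ 0 ⊎ x % 4 ≡ 2 → x % 2 ≡ 0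
even-from-mod4 x x%4 = ≡.trans (≡.sym (m∣n⇒o%n%m≡o%m 2 4 x (divides 2 ≡.refl))) (even x%4)
  where
    even : x % 4 ≡ 0 ⊎ x % 4 ≡ 2 → x % 4 % 2 ≡ 0
    even (inj₁ eq) = ≡.cong (_% 2) eq
    even (inj₂ eq) = ≡.cong (_% 2) eq

m%2≡0⇒m≡m/2*2 : ∀ m → m % 2 ≡ 0 → m ≡ m / 2 * 2
m%2≡0⇒m≡m/2*2 m m%2≡0 = ≡.trans (m≡m%n+[m/n]*n m 2) (≡.cong (_+ m / 2 * 2) m%2≡0)

-- m s ≡ 0 and n k ≡ 2 n (mod 4) force n to be even
even-columns : ∀ m n s k → m * s ≡ n * k → s % 4 ≡ 0 → k % 4 ≡ 2 → n % 2 ≡ 0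
even-columns m n s k ms≡nk s%4 k%4 = even-from-mod4 n (by-residue (n % 4) ≡.refl (m%n<n n 4))
  where
    nk%4≡0 : n * k % 4 ≡ 0
    nk%4≡0 = ≡.trans (≡.cong (_% 4) (≡.sym ms≡nk))
               (≡.trans (%-distribˡ-* m s 4) (≡.trans (≡.cong (λ r → m % 4 * r % 4) s%4) (≡.cong (_% 4) (*-zeroʳ (m % 4)))))
    nk%4 : ∀ r → n % 4 ≡ r → n * k % 4 ≡ r * 2 % 4
    nk%4 r eq = ≡.trans (%-distribˡ-* n k 4) (≡.cong₂ (λ x y → x * y % 4) eq k%4)
    by-residue : ∀ r → n % 4 ≡ r → r < 4 → n % 4 ≡ 0 ⊎ n % 4 ≡ 2
    by-residue 0 eq _ = inj₁ eq
    by-residue 1 eq _ with ≡.trans (≡.sym (nk%4 1 eq)) nk%4≡0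
    ... | ()
    by-residue 2 eq _ = inj₂ eq
    by-residue 3 eq _ with ≡.trans (≡.sym (nk%4 3 eq)) nk%4≡0
    ... | ()
    by-residue (suc (suc (suc (suc _)))) _ (s≤s (s≤s (s≤s (s≤s ()))))

Residues : ℕ → ℕ → ℕ → ℕ → Set
Residues m n s k = (s % 4 ≡ 0 × k % 4 ≡ 0)
                 ⊎ (s % 4 ≡ 2 × k % 4 ≡ 0)
                 ⊎ (s % 4 ≡ 0 × k % 4 ≡ 2)
                 ⊎ (s % 4 ≡ 2 × k % 4 ≡ 2 × m % 2 ≡ 0 × n % 2 ≡ 0)

rows-even : ∀ m n s k → Residues m n s k → s % 2 ≡ 0
rows-even m n s k residues = even-from-mod4 s (row-residue residues)
  where
    row-residue : Residues m n s k → s % 4 ≡ 0 ⊎ s % 4 ≡ 2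
    row-residue (inj₁ (s%4 , _))               = inj₁ s%4
    row-residue (inj₂ (inj₁ (s%4 , _)))        = inj₂ s%4
    row-residue (inj₂ (inj₂ (inj₁ (s%4 , _)))) = inj₁ s%4
    row-residue (inj₂ (inj₂ (inj₂ (s%4 , _)))) = inj₂ s%4

column-residue : ∀ m n s k → m * s ≡ n * k → Residues m n s k → k % 4 ≡ 0 ⊎ (k % 4 ≡ 2 × n % 2 ≡ 0)
column-residue m n s k _     (inj₁ (_ , k%4))                         = inj₁ k%4
column-residue m n s k _     (inj₂ (inj₁ (_ , k%4)))                  = inj₁ k%4
column-residue m n s k ms≡nk (inj₂ (inj₂ (inj₁ (s%4 , k%4))))         = inj₂ (k%4 , even-columns m n s k ms≡nk s%4 k%4)
column-residue m n s k _     (inj₂ (inj₂ (inj₂ (_ , k%4 , _ , n%2)))) = inj₂ (k%4 , n%2)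

module _ {a ℓ} (Γ : AbelianGroup a ℓ) where

  -- columns are paired at distance 2 when 4 ∣ k, and at distance 1 when k ≡ 2 (mod 4) and n is even
  mrs-by-columns : ∀ {m n s k c} .{{_ : NonZero m}} .{{_ : NonZero s}} .{{_ : NonZero n}} .{{_ : NonZero c}} →
                   2 ≤ s → s ≤ n → 2 ≤ k → m * s ≡ n * k → HasOrder Γ (n * k * c) → s % 2 ≡ 0 →
                   k % 4 ≡ 0 ⊎ (k % 4 ≡ 2 × n % 2 ≡ 0) → MRS Γ m n s k c
  mrs-by-columns {n = n} {s} {k} _ s≤n 2≤k ms≡nk enum s%2 (inj₁ k%4) =
    mrs-from-factorisation Γ s≤n ms≡nk enum (s / 2) 2 n (k / 4) {{it}} {{nonZero-factor (k / 4) 4 k≡ 2≤k}}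
      (m%2≡0⇒m≡m/2*2 s s%2) ≡.refl k≡
    where
      k≡ : k ≡ k / 4 * 4
      k≡ = ≡.trans (m≡m%n+[m/n]*n k 4) (≡.cong (_+ k / 4 * 4) k%4)
  mrs-by-columns {n = n} {s} {k} 2≤s s≤n 2≤k ms≡nk enum s%2 (inj₂ (k%4 , n%2)) =
    mrs-from-factorisation Γ s≤n ms≡nk enum (s / 2) 1 (n / 2) (k / 2)
      {{nonZero-factor (n / 2) 2 n≡ (≤-trans 2≤s s≤n)}} {{nonZero-factor (k / 2) 2 k≡ 2≤k}}
      (m%2≡0⇒m≡m/2*2 s s%2) (≡.trans (*-identityʳ n) n≡) k≡
    where
      n≡ : n ≡ n / 2 * 2
      n≡ = m%2≡0⇒m≡m/2*2 n n%2
      k≡ : k ≡ k / 2 * 2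
      k≡ = m%2≡0⇒m≡m/2*2 k (even-from-mod4 k (inj₂ k%4))

proposition5p15 : ∀ {a ℓ : Level} (m n s k c : ℕ) →
    2 ≤ s → s ≤ n → 2 ≤ k → k ≤ m → m * s ≡ n * k → 1 ≤ c →
    (Γ : AbelianGroup a ℓ) → HasOrder Γ (n * k * c) →
    ((s % 4 ≡ 0 × k % 4 ≡ 0)
      ⊎ (s % 4 ≡ 2 × k % 4 ≡ 0)
      ⊎ (s % 4 ≡ 0 × k % 4 ≡ 2)
      ⊎ (s % 4 ≡ 2 × k % 4 ≡ 2 × m % 2 ≡ 0 × n % 2 ≡ 0)) →
    MRS Γ m n s k c
proposition5p15 m n s k c 2≤s s≤n 2≤k k≤m ms≡nk 1≤c Γ enum residues =
  mrs-by-columns Γ 2≤s s≤n 2≤k ms≡nk enum (rows-even m n s k residues) (column-residue m n s k ms≡nk residues)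
  where
    instance
      nonZero-m : NonZero m
      nonZero-m = >-nonZero (<-≤-trans z<s (≤-trans 2≤k k≤m))
      nonZero-n : NonZero n
      nonZero-n = >-nonZero (<-≤-trans z<s (≤-trans 2≤s s≤n))
      nonZero-s : NonZero s
      nonZero-s = >-nonZero (<-≤-trans z<s 2≤s)
      nonZero-c : NonZero c
      nonZero-c = >-nonZero 1≤c
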